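{- For any $\lambda\in\mathbf{k}$, the vector space $\mathrm{HSym}=\bigoplus_{n\ge 0}\mathbf{k}\mathfrak{B}_n$ equipped with the shifted quasi-shuffle product $\overline{\star}_\lambda$ is a unital associative $\mathbf{k}$-algebra (with unit the empty signed permutation $\imath$).
   Context: $\mathbf{k}$ is a field of characteristic zero. For $n\ge0$, a signed permutation of $[n]$ is a permutation $\pi$ of $\{ -n,\dots,-1,0,1,\dots,n\}$ with $\pi(-i)=-\pi(i)$; it is written as the word $\pi_1\cdots\pi_n$ with $\pi_i=\pi(i)$, and $\mathfrak{B}_n$ is the set of these ($\mathfrak{B}_0=\{\imath\}$). We write $i^-$ for $-i$. For a word $w=a_1\cdots a_n$ on $\mathbb{Z}\setminus\{0\}$, its standardization $\mathrm{st}(w)=b_1\cdots b_n\in\mathfrak{B}_n$ is the unique signed permutation such that $b_i$ and $a_i$ have the same sign for all $i$, and $|b_i|<|b_j|$ whenever $|a_i|<|a_j|$, or $|a_i|=|a_j|$ and $i<j$; $\mathrm{st}$ is extended linearly. Let $A=\mathbb{Z}\setminus\{0\}$ and define the product $\bullet$ on $\mathbf{k}A$ by $a\bullet b=a$ if $a<0$ and $b<0$, and $a\bullet b=0$ otherwise. Let $\star_\lambda$ be the quasi-shuffle product of weight $\lambda$ on words over $A$: the bilinear product with the empty word $\imath$ as identity and $au\star_\lambda bv=a(u\star_\lambda bv)+b(au\star_\lambda v)+\lambda(a\bullet b)(u\star_\lambda v)$ for letters $a,b$ and words $u,v$. For $\tau\in\mathfrak{B}_n$ and $m\ge0$, $\tau[m]$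 is the word obtained from $\tau$ by replacing each positive letter $i$ by $i+m$ and each negative letter $i^-$ by $(i+m)^-$. For $\sigma\in\mathfrak{B}_m,\tau\in\mathfrak{B}_n$, define $\sigma\overline{\star}_\lambda\tau=\mathrm{st}(\sigma\star_\lambda\tau[m])$, extended bilinearly. -}

module Defs where

open import Level using (Level; _⊔_)
open import Algebra.Bundles using (CommutativeRing)
open import Data.Nat as ℕ using (ℕ; zero; suc)
open import Data.Integer as ℤ using (ℤ; +_; -[1+_]; ∣_∣)
open import Data.List using (List; []; _∷_; _++_; map; length; upTo; concatMap; foldr)
open import Data.List.Properties using (≡-dec)
open import Data.List.Relation.Unary.All using (All)
open import Data.List.Relation.Binary.Permutation.Propositional using (_↭_)
open import Data.Product using (_×_; _,_; proj₁; proj₂; Σ; ∃)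
open import Data.Bool using (Bool; true; false; if_then_else_; _∧_)
open import Relation.Nullary using (¬_; Dec; yes; no; does)

-- Letters are nonzero integers; a word is a list of integers.
Word : Set
Word = List ℤ

IsSignedPerm : Word → Set
IsSignedPerm w = map ∣_∣ w ↭ map suc (upTo (length w))

isNeg : ℤ → Bool
isNeg -[1+ _ ] = true
isNeg (+ _)    = false

countLt : ℤ → Word → ℕ
countLt a [] = 0
countLt a (b ∷ v) = (if does (∣ b ∣ ℕ.<? ∣ a ∣) then 1 else 0) ℕ.+ countLt a v

countEq : ℤ → Word → ℕ
countEq a [] = 0
countEq a (b ∷ v) = (if does (∣ b ∣ ℕ.≟ ∣ a ∣) then 1 else 0) ℕ.+ countEq a v

signedLike : ℤ → ℕ → ℤ
signedLike (+ _)    r = + suc r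
signedLike -[1+ _ ] r = -[1+ r ]

-- stGo full pre rest : the standardized letters of the suffix `rest`
-- of `full`, where `pre` is the prefix before it.
-- |b_i| = 1 + #{j : |a_j| < |a_i|} + #{j < i : |a_j| = |a_i|},
-- and b_i has the sign of a_i.
stGo : Word → Word → Word → Word
stGo full pre [] = []
stGo full pre (a ∷ rest) =
  signedLike a (countLt a full ℕ.+ countEq a pre) ∷ stGo full (pre ++ (a ∷ [])) rest

st : Word → Word
st w = stGo w [] w

shiftL : ℕ → ℤ → ℤ
shiftL m (+ n)      = + (n ℕ.+ m)
shiftL m -[1+ n ]   = -[1+ (n ℕ.+ m) ]

shiftW : ℕ → Word → Word
shiftW m = map (shiftL m)

module _ {c ℓ : Level} (K : CommutativeRing c ℓ) where
  open CommutativeRing K using (Carrier; _≈_; _+_; _*_; 0#; 1#)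

  IsField : Set (c ⊔ ℓ)
  IsField = (¬ (0# ≈ 1#)) × (∀ x → ¬ (x ≈ 0#) → ∃ λ y → (x * y) ≈ 1#)

  natMul : ℕ → Carrier
  natMul zero    = 0#
  natMul (suc n) = 1# + natMul n

  CharZero : Set ℓ
  CharZero = ∀ n → ¬ (natMul (suc n) ≈ 0#)

module HSymDefs {c ℓ : Level} (K : CommutativeRing c ℓ) (lam : CommutativeRing.Carrier K) where
  open CommutativeRing K using (Carrier; _≈_; _+_; _*_; 0#; 1#)

  -- A finite formal k-linear combination of words: a list of
  -- (coefficient, word) pairs, understood as the sum Σ c·w.
  LC : Set c
  LC = List (Carrier × Word)

  coeff : Word → LC → Carrier
  coeff w [] = 0#
  coeff w ((k , u) ∷ x) = (if does (≡-dec ℤ._≟_ u w) then k else 0#) + coeff w x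

  infix 4 _≈ᴸ_
  _≈ᴸ_ : LC → LC → Set ℓ
  x ≈ᴸ y = ∀ w → coeff w x ≈ coeff w y

  infixl 6 _⊕_
  _⊕_ : LC → LC → LC
  x ⊕ y = x ++ y

  infixr 7 _·_
  _·_ : Carrier → LC → LC
  k · x = map (λ p → (k * proj₁ p , proj₂ p)) x

  pre : ℤ → LC → LC
  pre a = map (λ p → (proj₁ p , a ∷ proj₂ p))

  qsh : Word → Word → LC
  qsh [] v = (1# , v) ∷ []
  qsh (a ∷ u) [] = (1# , a ∷ u) ∷ []
  qsh (a ∷ u) (b ∷ v) =
    pre a (qsh u (b ∷ v)) ++ pre b (qsh (a ∷ u) v) ++
    (if isNeg a ∧ isNeg b then lam · pre a (qsh u v) else [])

  shqshW : Word → Word → LC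
  shqshW σ τ = map (λ p → (proj₁ p , st (proj₂ p))) (qsh σ (shiftW (length σ) τ))

  infixl 7 _⋆̄_
  _⋆̄_ : LC → LC → LC
  x ⋆̄ y = concatMap (λ p → concatMap (λ q → (proj₁ p * proj₁ q) · shqshW (proj₂ p) (proj₂ q)) y) x

  unit : LC
  unit = (1# , []) ∷ []

  InHSym : LC → Set c
  InHSym x = All (λ p → IsSignedPerm (proj₂ p)) x

  record IsUnitalAssocAlgebra : Set (c ⊔ ℓ) where
    field
      closed     : ∀ x y → InHSym x → InHSym y → InHSym (x ⋆̄ y)
      unit-in    : InHSym unit
      ⋆̄-cong     : ∀ x x′ y y′ → InHSym x → InHSym x′ → InHSym y → InHSym y′ →
                   x ≈ᴸ x′ → y ≈ᴸ y′ → (x ⋆̄ y) ≈ᴸ (x′ ⋆̄ y′)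
      ⋆̄-distribˡ   : ∀ x y z → InHSym x → InHSym y → InHSym z →
                   (x ⋆̄ (y ⊕ z)) ≈ᴸ ((x ⋆̄ y) ⊕ (x ⋆̄ z))
      ⋆̄-distribʳ   : ∀ x y z → InHSym x → InHSym y → InHSym z →
                   ((x ⊕ y) ⋆̄ z) ≈ᴸ ((x ⋆̄ z) ⊕ (y ⋆̄ z))
      scalarˡ    : ∀ k x y → InHSym x → InHSym y → ((k · x) ⋆̄ y) ≈ᴸ (k · (x ⋆̄ y))
      scalarʳ    : ∀ k x y → InHSym x → InHSym y → (x ⋆̄ (k · y)) ≈ᴸ (k · (x ⋆̄ y))
      ⋆̄-assoc    : ∀ x y z → InHSym x → InHSym y → InHSym z →
                   ((x ⋆̄ y) ⋆̄ z) ≈ᴸ (x ⋆̄ (y ⋆̄ z))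
      ⋆̄-identityˡ : ∀ x → InHSym x → (unit ⋆̄ x) ≈ᴸ x
      ⋆̄-identityʳ : ∀ x → InHSym x → (x ⋆̄ unit) ≈ᴸ x

-- Linear combinations are compared through their evaluations against arbitrary functions
-- g : Word → k, which determine the coefficients and conversely; all algebra laws become
-- identities between evaluations.  On a word W whose letters have
-- distinct absolute values, such as σ τ[m], standardization is the letterwise relabelling
-- a ↦ ±(1 + #{b ∈ W : |b| < |a|}), which preserves signs and the order of absolute values.
-- The quasi-shuffle commutes with sign-preserving relabellings and standardization is invariant
-- under order- and sign-preserving ones, so (σ ⋆̄ τ) ⋆̄ ρ and σ ⋆̄ (τ ⋆̄ ρ) are the standardizations
-- of the two bracketings of σ ⋆ τ[m] ⋆ ρ[m+n].  These agree by associativity of the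
-- quasi-shuffle, proved by induction after sorting terms by how their first letter arises.

module Submission where

open import Defs
open import Level using (Level; _⊔_)
open import Algebra.Bundles using (CommutativeRing)
open import Data.Bool using (Bool; true; false; if_then_else_; _∧_)
open import Data.Empty using (⊥-elim)
open import Data.Unit using (⊤; tt)
open import Data.Integer as ℤ using (ℤ; +_; -[1+_]; ∣_∣)
open import Data.List using (List; []; _∷_; _++_; [_]; map; length; upTo; concatMap)
import Data.List.Properties as Listₚ
open import Data.List.Membership.Propositional using (_∈_)
open import Data.List.Relation.Unary.Any using (here; there)
open import Data.List.Membership.Propositional.Properties using (∈-upTo⁻; ∈-∃++)
open import Data.List.Relation.Unary.All as All using (All; []; _∷_)
import Data.List.Relation.Unary.All.Properties as Allₚ
open import Data.List.Relation.Unary.Unique.Propositional using (Unique; []; _∷_)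
import Data.List.Relation.Unary.Unique.Propositional.Properties as Uniqueₚ
open import Data.List.Relation.Binary.Permutation.Propositional as ↭ using (_↭_; ↭-sym; ↭-trans)
import Data.List.Relation.Binary.Permutation.Propositional.Properties as ↭ₚ
open import Data.Nat as ℕ using (ℕ; zero; suc; _≤_; _<_; z≤n; s≤s)
import Data.Nat.Properties as ℕₚ
open import Data.Product using (_×_; _,_; proj₁; proj₂; Σ-syntax)
open import Data.Sum using (_⊎_; inj₁; inj₂)
open import Function.Bundles using (_⇔_; mk⇔)
open import Function using (_∘_)
open import Relation.Binary.Definitions using (tri<; tri≈; tri>)
open import Relation.Binary.PropositionalEquality
  using (_≡_; _≢_; refl; sym; trans; cong; cong₂; subst; subst₂; module ≡-Reasoning)
open import Relation.Nullary using (¬_; Dec; yes; no; does)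
open import Relation.Nullary.Decidable using (dec-true; dec-false; does-⇔)
open import Data.List.Properties using (≡-dec)
open import Algebra.Properties.CommutativeSemigroup ℕₚ.+-commutativeSemigroup
  using (x∙yz≈y∙xz; interchange)

-- Written with if_then_else_ so that count agrees definitionally with countLt and countEq.
𝟙 : Bool → ℕ
𝟙 b = if b then 1 else 0

count : (ℕ → Bool) → List ℕ → ℕ
count p []       = 0
count p (x ∷ xs) = 𝟙 (p x) ℕ.+ count p xs

count< : ℕ → List ℕ → ℕ
count< k = count (λ x → does (x ℕ.<? k))

count≡ : ℕ → List ℕ → ℕ
count≡ k = count (λ x → does (x ℕ.≟ k))

𝟙-true : ∀ {p} {P : Set p} (d : Dec P) → P → 𝟙 (does d) ≡ 1
𝟙-true d p = cong 𝟙 (dec-true d p)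

𝟙-false : ∀ {p} {P : Set p} (d : Dec P) → ¬ P → 𝟙 (does d) ≡ 0
𝟙-false d ¬p = cong 𝟙 (dec-false d ¬p)

count-++ : ∀ p xs ys → count p (xs ++ ys) ≡ count p xs ℕ.+ count p ys
count-++ p []       ys = refl
count-++ p (x ∷ xs) ys =
  trans (cong (𝟙 (p x) ℕ.+_) (count-++ p xs ys)) (sym (ℕₚ.+-assoc (𝟙 (p x)) _ _))

count-↭ : ∀ p {xs ys} → xs ↭ ys → count p xs ≡ count p ys
count-↭ p ↭.refl          = refl
count-↭ p (↭.prep x q)    = cong (𝟙 (p x) ℕ.+_) (count-↭ p q)
count-↭ p (↭.swap x y q)  =
  trans (cong (λ t → 𝟙 (p x) ℕ.+ (𝟙 (p y) ℕ.+ t)) (count-↭ p q)) (x∙yz≈y∙xz (𝟙 (p x)) (𝟙 (p y)) _)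
count-↭ p (↭.trans q q′)  = trans (count-↭ p q) (count-↭ p q′)

count-map : ∀ p f xs → count p (map f xs) ≡ count (p ∘ f) xs
count-map p f []       = refl
count-map p f (x ∷ xs) = cong (𝟙 (p (f x)) ℕ.+_) (count-map p f xs)

count-+-≤ : ∀ p q r xs → (∀ x → 𝟙 (p x) ℕ.+ 𝟙 (q x) ≤ 𝟙 (r x)) →
            count p xs ℕ.+ count q xs ≤ count r xs
count-+-≤ p q r []       _  = z≤n
count-+-≤ p q r (x ∷ xs) le =
  subst (_≤ count r (x ∷ xs)) (interchange (𝟙 (p x)) (𝟙 (q x)) (count p xs) (count q xs))
    (ℕₚ.+-mono-≤ (le x) (count-+-≤ p q r xs le))

count-all : ∀ p xs → All (λ x → p x ≡ true) xs → count p xs ≡ length xs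
count-all p []       []         = refl
count-all p (x ∷ xs) (px ∷ pxs) rewrite px = cong suc (count-all p xs pxs)

count<+count≡≤count< : ∀ {j k} xs → j < k → count< j xs ℕ.+ count≡ j xs ≤ count< k xs
count<+count≡≤count< {j} {k} xs j<k = count-+-≤ _ _ _ xs pointwise
  where
  pointwise : ∀ x → 𝟙 (does (x ℕ.<? j)) ℕ.+ 𝟙 (does (x ℕ.≟ j)) ≤ 𝟙 (does (x ℕ.<? k))
  pointwise x = go (x ℕ.<? j) (x ℕ.≟ j) (x ℕ.<? k)
    where
    go : (p : Dec (x < j)) (q : Dec (x ≡ j)) (r : Dec (x < k)) → 𝟙 (does p) ℕ.+ 𝟙 (does q) ≤ 𝟙 (does r)
    go (yes x<j) (yes refl) _        = ⊥-elim (ℕₚ.<-irrefl refl x<j)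
    go (yes _)   (no _)     (yes _)  = ℕₚ.≤-refl
    go (yes x<j) (no _)     (no x≮k) = ⊥-elim (x≮k (ℕₚ.<-trans x<j j<k))
    go (no _)    (yes _)    (yes _)  = ℕₚ.≤-refl
    go (no _)    (yes refl) (no x≮k) = ⊥-elim (x≮k j<k)
    go (no _)    (no _)     _        = z≤n

count<+count≡≤length : ∀ k xs → count< k xs ℕ.+ count≡ k xs ≤ length xs
count<+count≡≤length k xs =
  subst (count< k xs ℕ.+ count≡ k xs ≤_) (count-all (λ _ → true) xs (All.universal (λ _ → refl) xs))
    (count-+-≤ (λ x → does (x ℕ.<? k)) (λ x → does (x ℕ.≟ k)) (λ _ → true) xs pointwise)
  where
  pointwise : ∀ x → 𝟙 (does (x ℕ.<? k)) ℕ.+ 𝟙 (does (x ℕ.≟ k)) ≤ 1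
  pointwise x = go (x ℕ.<? k) (x ℕ.≟ k)
    where
    go : (p : Dec (x < k)) (q : Dec (x ≡ k)) → 𝟙 (does p) ℕ.+ 𝟙 (does q) ≤ 1
    go (yes x<k) (yes refl) = ⊥-elim (ℕₚ.<-irrefl refl x<k)
    go (yes _)   (no _)     = ℕₚ.≤-refl
    go (no _)    (yes _)    = ℕₚ.≤-refl
    go (no _)    (no _)     = z≤n

count≡-++-∷ : ∀ k xs ys → count≡ k (xs ++ k ∷ ys) ≡ suc (count≡ k xs ℕ.+ count≡ k ys)
count≡-++-∷ k xs ys =
  trans (count-++ _ xs (k ∷ ys))
    (trans (cong (λ t → count≡ k xs ℕ.+ (t ℕ.+ count≡ k ys)) (𝟙-true (k ℕ.≟ k) refl))
      (ℕₚ.+-suc (count≡ k xs) (count≡ k ys)))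

count≡-prefix< : ∀ k xs ys → count≡ k xs < count≡ k (xs ++ k ∷ ys)
count≡-prefix< k xs ys =
  subst (count≡ k xs <_) (sym (count≡-++-∷ k xs ys)) (s≤s (ℕₚ.m≤m+n _ _))

count≡≡0⇒All≢ : ∀ k xs → count≡ k xs ≡ 0 → All (_≢ k) xs
count≡≡0⇒All≢ k []       _ = []
count≡≡0⇒All≢ k (x ∷ xs) h = go (x ℕ.≟ k) h
  where
  go : (d : Dec (x ≡ k)) → 𝟙 (does d) ℕ.+ count≡ k xs ≡ 0 → All (_≢ k) (x ∷ xs)
  go (yes _)  ()
  go (no x≢k) h = x≢k ∷ count≡≡0⇒All≢ k xs h

All≢⇒count≡≡0 : ∀ k xs → All (_≢ k) xs → count≡ k xs ≡ 0
All≢⇒count≡≡0 k []       []           = refl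
All≢⇒count≡≡0 k (x ∷ xs) (x≢k ∷ x≢ks) =
  trans (cong (ℕ._+ count≡ k xs) (𝟙-false (x ℕ.≟ k) x≢k)) (All≢⇒count≡≡0 k xs x≢ks)

1≤count≡⇒∈ : ∀ k xs → 1 ≤ count≡ k xs → k ∈ xs
1≤count≡⇒∈ k (x ∷ xs) h = go (x ℕ.≟ k) h
  where
  go : (d : Dec (x ≡ k)) → 1 ≤ 𝟙 (does d) ℕ.+ count≡ k xs → k ∈ x ∷ xs
  go (yes refl) _ = here refl
  go (no _)     h = there (1≤count≡⇒∈ k xs h)

∈⇒1≤count≡ : ∀ {k xs} → k ∈ xs → 1 ≤ count≡ k xs
∈⇒1≤count≡ {k} k∈xs with P , R , refl ← ∈-∃++ k∈xs = ℕₚ.≤-trans (s≤s z≤n) (count≡-prefix< k P R)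

Distinct : List ℕ → Set
Distinct xs = ∀ k → count≡ k xs ≤ 1

Unique⇒Distinct : ∀ {xs} → Unique xs → Distinct xs
Unique⇒Distinct {[]}     []          k = z≤n
Unique⇒Distinct {x ∷ xs} (x∉xs ∷ xs!) k = go (x ℕ.≟ k)
  where
  go : (d : Dec (x ≡ k)) → 𝟙 (does d) ℕ.+ count≡ k xs ≤ 1
  go (yes refl) = ℕₚ.≤-reflexive (cong suc (All≢⇒count≡≡0 x xs (All.map (_∘ sym) x∉xs)))
  go (no _)     = Unique⇒Distinct xs! k

oneTo : ℕ → List ℕ
oneTo n = map suc (upTo n)

oneTo-positive : ∀ n → All (1 ≤_) (oneTo n)
oneTo-positive n = Allₚ.map⁺ (All.universal (λ _ → s≤s z≤n) (upTo n))

oneTo-≤ : ∀ n → All (_≤ n) (oneTo n)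
oneTo-≤ n = Allₚ.map⁺ (All.tabulate ∈-upTo⁻)

oneTo-distinct : ∀ n → Distinct (oneTo n)
oneTo-distinct n = Unique⇒Distinct (Uniqueₚ.map⁺ ℕₚ.suc-injective (Uniqueₚ.upTo⁺ n))

count<-upTo : ∀ {k} n → k ≤ n → count< k (upTo n) ≡ k
count<-upTo {k} zero    z≤n   = refl
count<-upTo {k} (suc n) k≤1+n =
  trans (cong (count< k) (sym (Listₚ.upTo-∷ʳ n)))
    (trans (count-++ _ (upTo n) [ n ]) (last (ℕₚ.m≤n⇒m<n∨m≡n k≤1+n)))
  where
  last : k < suc n ⊎ k ≡ suc n → count< k (upTo n) ℕ.+ (𝟙 (does (n ℕ.<? k)) ℕ.+ 0) ≡ k
  last (inj₁ (s≤s k≤n)) =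
    trans (cong₂ ℕ._+_ (count<-upTo n k≤n) (cong (ℕ._+ 0) (𝟙-false (n ℕ.<? k) (ℕₚ.≤⇒≯ k≤n))))
      (ℕₚ.+-identityʳ k)
  last (inj₂ refl) =
    trans (cong₂ ℕ._+_ below-all (cong (ℕ._+ 0) (𝟙-true (n ℕ.<? suc n) ℕₚ.≤-refl))) (ℕₚ.+-comm n 1)
    where
    below-all : count< (suc n) (upTo n) ≡ n
    below-all = trans (count-all _ (upTo n) (All.tabulate (λ i∈ → dec-true (_ ℕ.<? suc n) (ℕₚ.m≤n⇒m≤1+n (∈-upTo⁻ i∈)))))
                  (Listₚ.length-upTo n)

count<-oneTo : ∀ {k} n → k ≤ n → count< (suc k) (oneTo n) ≡ k
count<-oneTo n k≤n = trans (count-map _ suc (upTo n)) (count<-upTo n k≤n)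

oneTo-suc : ∀ n → oneTo (suc n) ≡ oneTo n ++ [ suc n ]
oneTo-suc n = trans (cong (map suc) (sym (Listₚ.upTo-∷ʳ n))) (Listₚ.map-++ suc (upTo n) [ n ])

oneTo-+ : ∀ m n → oneTo (m ℕ.+ n) ≡ oneTo m ++ map (ℕ._+ m) (oneTo n)
oneTo-+ m zero    = trans (cong oneTo (ℕₚ.+-identityʳ m)) (sym (Listₚ.++-identityʳ (oneTo m)))
oneTo-+ m (suc n) = begin
  oneTo (m ℕ.+ suc n)                                ≡⟨ cong oneTo (ℕₚ.+-suc m n) ⟩
  oneTo (suc (m ℕ.+ n))                              ≡⟨ oneTo-suc (m ℕ.+ n) ⟩
  oneTo (m ℕ.+ n) ++ [ suc (m ℕ.+ n) ]               ≡⟨ cong₂ (λ xs k → xs ++ [ k ]) (oneTo-+ m n) (cong suc (ℕₚ.+-comm m n)) ⟩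
  (oneTo m ++ map (ℕ._+ m) (oneTo n)) ++ [ suc n ℕ.+ m ] ≡⟨ Listₚ.++-assoc (oneTo m) _ _ ⟩
  oneTo m ++ map (ℕ._+ m) (oneTo n) ++ [ suc n ℕ.+ m ] ≡⟨ cong (oneTo m ++_) (sym (Listₚ.map-++ (ℕ._+ m) (oneTo n) [ suc n ])) ⟩
  oneTo m ++ map (ℕ._+ m) (oneTo n ++ [ suc n ])     ≡⟨ cong (λ xs → oneTo m ++ map (ℕ._+ m) xs) (sym (oneTo-suc n)) ⟩
  oneTo m ++ map (ℕ._+ m) (oneTo (suc n))            ∎
  where open ≡-Reasoning

remove : ∀ m xs → Distinct xs → 1 ≤ count≡ m xs →
         Σ[ ys ∈ List ℕ ] xs ↭ m ∷ ys × Distinct ys × All (_≢ m) ys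
remove m xs xs! m∈xs with as , bs , refl ← ∈-∃++ (1≤count≡⇒∈ m xs m∈xs) =
  as ++ bs , ↭ₚ.shift m as bs , ys! , m∉ys
  where
  count≡-shift : ∀ k → count≡ k (as ++ m ∷ bs) ≡ 𝟙 (does (m ℕ.≟ k)) ℕ.+ count≡ k (as ++ bs)
  count≡-shift k = count-↭ _ (↭ₚ.shift m as bs)
  ys! : Distinct (as ++ bs)
  ys! k = ℕₚ.≤-trans (ℕₚ.m≤n+m _ _) (subst (_≤ 1) (count≡-shift k) (xs! k))
  m∉ys : All (_≢ m) (as ++ bs)
  m∉ys = count≡≡0⇒All≢ m (as ++ bs) (ℕₚ.n≤0⇒n≡0 (ℕₚ.≤-pred
           (subst (_≤ 1) (trans (count≡-shift m) (cong (ℕ._+ count≡ m (as ++ bs)) (𝟙-true (m ℕ.≟ m) refl))) (xs! m))))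

<-suc-≢⇒< : ∀ {m} xs → All (_< suc m) xs → All (_≢ m) xs → All (_< m) xs
<-suc-≢⇒< xs <1+m ≢m = All.zipWith (λ (x<1+m , x≢m) → ℕₚ.≤∧≢⇒< (ℕₚ.≤-pred x<1+m) x≢m) (<1+m , ≢m)

absent⇒All≢ : ∀ m xs → ¬ (1 ≤ count≡ m xs) → All (_≢ m) xs
absent⇒All≢ m xs m∉xs = count≡≡0⇒All≢ m xs (ℕₚ.n≤0⇒n≡0 (ℕₚ.≮⇒≥ m∉xs))

length-distinct-< : ∀ m xs → Distinct xs → All (_< m) xs → length xs ≤ m
length-distinct-< zero    []       _   _          = z≤n
length-distinct-< zero    (x ∷ xs) _   (() ∷ _)
length-distinct-< (suc m) xs       xs! xs<1+m with 1 ℕ.≤? count≡ m xs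
... | no m∉xs = ℕₚ.m≤n⇒m≤1+n (length-distinct-< m xs xs! (<-suc-≢⇒< xs xs<1+m (absent⇒All≢ m xs m∉xs)))
... | yes m∈xs with ys , xs↭m∷ys , ys! , m∉ys ← remove m xs xs! m∈xs =
  subst (_≤ suc m) (sym (↭ₚ.↭-length xs↭m∷ys))
    (s≤s (length-distinct-< m ys ys! (<-suc-≢⇒< ys (All.tail (↭ₚ.All-resp-↭ xs↭m∷ys xs<1+m)) m∉ys)))

distinct-upTo-↭ : ∀ n xs → Distinct xs → All (_< n) xs → length xs ≡ n → xs ↭ upTo n
distinct-upTo-↭ zero    []  _   _      _  = ↭.refl
distinct-upTo-↭ (suc m) xs xs! xs<1+m len with 1 ℕ.≤? count≡ m xs
... | no m∉xs = ⊥-elim (ℕₚ.<-irrefl len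
      (s≤s (length-distinct-< m xs xs! (<-suc-≢⇒< xs xs<1+m (absent⇒All≢ m xs m∉xs)))))
... | yes m∈xs with ys , xs↭m∷ys , ys! , m∉ys ← remove m xs xs! m∈xs =
  ↭-trans xs↭m∷ys (↭-trans (↭.prep m ys↭upTo) (subst (m ∷ upTo m ↭_) (Listₚ.upTo-∷ʳ m) (↭ₚ.∷↭∷ʳ m (upTo m))))
  where
  ys↭upTo : ys ↭ upTo m
  ys↭upTo = distinct-upTo-↭ m ys ys! (<-suc-≢⇒< ys (All.tail (↭ₚ.All-resp-↭ xs↭m∷ys xs<1+m)) m∉ys)
              (ℕₚ.suc-injective (trans (sym (↭ₚ.↭-length xs↭m∷ys)) len))

countLt≡count< : ∀ a w → countLt a w ≡ count< ∣ a ∣ (map ∣_∣ w)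
countLt≡count< a []      = refl
countLt≡count< a (b ∷ w) = cong (_ ℕ.+_) (countLt≡count< a w)

countEq≡count≡ : ∀ a w → countEq a w ≡ count≡ ∣ a ∣ (map ∣_∣ w)
countEq≡count≡ a []      = refl
countEq≡count≡ a (b ∷ w) = cong (_ ℕ.+_) (countEq≡count≡ a w)

countLt-cong : ∀ {a b} W → ∣ a ∣ ≡ ∣ b ∣ → countLt a W ≡ countLt b W
countLt-cong {a} {b} W e =
  trans (countLt≡count< a W) (trans (cong (λ k → count< k (map ∣_∣ W)) e) (sym (countLt≡count< b W)))

countEq-cong : ∀ {a b} W → ∣ a ∣ ≡ ∣ b ∣ → countEq a W ≡ countEq b W
countEq-cong {a} {b} W e =
  trans (countEq≡count≡ a W) (trans (cong (λ k → count≡ k (map ∣_∣ W)) e) (sym (countEq≡count≡ b W)))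

countLt+countEq≤countLt : ∀ {a b} W → ∣ a ∣ < ∣ b ∣ → countLt a W ℕ.+ countEq a W ≤ countLt b W
countLt+countEq≤countLt {a} {b} W lt
  rewrite countLt≡count< a W | countEq≡count≡ a W | countLt≡count< b W = count<+count≡≤count< (map ∣_∣ W) lt

countLt+countEq≤length : ∀ a W → countLt a W ℕ.+ countEq a W ≤ length W
countLt+countEq≤length a W
  rewrite countLt≡count< a W | countEq≡count≡ a W | sym (Listₚ.length-map ∣_∣ W) =
  count<+count≡≤length ∣ a ∣ (map ∣_∣ W)

countEq-prefix< : ∀ pre a rest → countEq a pre < countEq a (pre ++ a ∷ rest)
countEq-prefix< pre a rest
  rewrite countEq≡count≡ a pre | countEq≡count≡ a (pre ++ a ∷ rest) | Listₚ.map-++ ∣_∣ pre (a ∷ rest) =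
  count≡-prefix< ∣ a ∣ (map ∣_∣ pre) (map ∣_∣ rest)

∣signedLike∣ : ∀ a r → ∣ signedLike a r ∣ ≡ suc r
∣signedLike∣ (+ _)    r = refl
∣signedLike∣ -[1+ _ ] r = refl

isNeg-signedLike : ∀ a r → isNeg (signedLike a r) ≡ isNeg a
isNeg-signedLike (+ _)    r = refl
isNeg-signedLike -[1+ _ ] r = refl

signedLike-sign : ∀ {a b} r → isNeg a ≡ isNeg b → signedLike a r ≡ signedLike b r
signedLike-sign {+ _}      {+ _}      r _ = refl
signedLike-sign { -[1+ _ ]} { -[1+ _ ]} r _ = refl
signedLike-sign {+ _}      { -[1+ _ ]} r ()
signedLike-sign { -[1+ _ ]} {+ _}      r ()

rank : Word → Word → ℤ → ℕ
rank full pre a = countLt a full ℕ.+ countEq a pre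

ranks : Word → Word → Word → List ℕ
ranks full pre []         = []
ranks full pre (a ∷ rest) = rank full pre a ∷ ranks full (pre ++ [ a ]) rest

∣stGo∣ : ∀ full pre rest → map ∣_∣ (stGo full pre rest) ≡ map suc (ranks full pre rest)
∣stGo∣ full pre []         = refl
∣stGo∣ full pre (a ∷ rest) = cong₂ _∷_ (∣signedLike∣ a _) (∣stGo∣ full (pre ++ [ a ]) rest)

length-stGo : ∀ full pre rest → length (stGo full pre rest) ≡ length rest
length-stGo full pre []         = refl
length-stGo full pre (a ∷ rest) = cong suc (length-stGo full (pre ++ [ a ]) rest)

length-st : ∀ w → length (st w) ≡ length w
length-st w = length-stGo w [] w

length-ranks : ∀ full pre rest → length (ranks full pre rest) ≡ length rest
length-ranks full pre []         = refl
length-ranks full pre (a ∷ rest) = cong suc (length-ranks full (pre ++ [ a ]) rest)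

++-∷-assoc : ∀ (pre : Word) a rest → pre ++ a ∷ rest ≡ (pre ++ [ a ]) ++ rest
++-∷-assoc pre a rest = sym (Listₚ.++-assoc pre [ a ] rest)

rank<length : ∀ full pre a rest → full ≡ pre ++ a ∷ rest → rank full pre a < length full
rank<length full pre a rest refl =
  ℕₚ.<-≤-trans (ℕₚ.+-monoʳ-< (countLt a full) (countEq-prefix< pre a rest)) (countLt+countEq≤length a full)

ranks<length : ∀ full pre rest → full ≡ pre ++ rest → All (_< length full) (ranks full pre rest)
ranks<length full pre []         _ = []
ranks<length full pre (a ∷ rest) e =
  rank<length full pre a rest e ∷ ranks<length full (pre ++ [ a ]) rest (trans e (++-∷-assoc pre a rest))

-- Equal absolute values are told apart by the prefix count, different ones by the count of smaller letters.
rank≢ : ∀ full {a b} P P′ → countEq a P < countEq a full → countEq b P′ < countEq b full →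
        (∣ a ∣ ≡ ∣ b ∣ → countEq a P < countEq a P′) → rank full P a ≢ rank full P′ b
rank≢ full {a} {b} P P′ a-later b-later same-abs e with ℕₚ.<-cmp ∣ a ∣ ∣ b ∣
... | tri< a<b _ _ = ℕₚ.<-irrefl e (ℕₚ.<-≤-trans (ℕₚ.+-monoʳ-< (countLt a full) a-later)
                       (ℕₚ.≤-trans (countLt+countEq≤countLt full a<b) (ℕₚ.m≤m+n _ _)))
... | tri≈ _ a≈b _ = ℕₚ.<-irrefl (trans e (cong₂ ℕ._+_ (countLt-cong full (sym a≈b)) (countEq-cong P′ (sym a≈b))))
                       (ℕₚ.+-monoʳ-< (countLt a full) (same-abs a≈b))
... | tri> _ _ b<a = ℕₚ.<-irrefl (sym e) (ℕₚ.<-≤-trans (ℕₚ.+-monoʳ-< (countLt b full) b-later)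
                       (ℕₚ.≤-trans (countLt+countEq≤countLt full b<a) (ℕₚ.m≤m+n _ _)))

rank≢later : ∀ full pre a mid rest → full ≡ (pre ++ a ∷ mid) ++ rest →
             All (rank full pre a ≢_) (ranks full (pre ++ a ∷ mid) rest)
rank≢later full pre a mid []         _ = []
rank≢later full pre a mid (b ∷ rest) e =
  rank≢ full pre (pre ++ a ∷ mid) (countEq-before a-pos) (countEq-before e) (λ _ → countEq-prefix< pre a mid)
  ∷ subst (λ P → All (rank full pre a ≢_) (ranks full P rest)) (sym mid-assoc)
      (rank≢later full pre a (mid ++ [ b ]) rest (trans e (trans (++-∷-assoc _ b rest) (cong (_++ rest) mid-assoc))))
  where
  mid-assoc : (pre ++ a ∷ mid) ++ [ b ] ≡ pre ++ a ∷ mid ++ [ b ]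
  mid-assoc = Listₚ.++-assoc pre (a ∷ mid) [ b ]
  a-pos : full ≡ pre ++ a ∷ mid ++ b ∷ rest
  a-pos = trans e (Listₚ.++-assoc pre (a ∷ mid) (b ∷ rest))
  countEq-before : ∀ {c P R} → full ≡ P ++ c ∷ R → countEq c P < countEq c full
  countEq-before {c} {P} {R} refl = countEq-prefix< P c R

ranks-unique : ∀ full pre rest → full ≡ pre ++ rest → Unique (ranks full pre rest)
ranks-unique full pre []         _ = []
ranks-unique full pre (a ∷ rest) e =
  rank≢later full pre a [] rest e′ ∷ ranks-unique full (pre ++ [ a ]) rest e′
  where e′ = trans e (++-∷-assoc pre a rest)

st-isSignedPerm : ∀ w → IsSignedPerm (st w)
st-isSignedPerm w =
  subst (λ n → map ∣_∣ (st w) ↭ oneTo n) (sym (length-st w))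
    (subst (_↭ oneTo (length w)) (sym (∣stGo∣ w [] w))
      (↭ₚ.map⁺ suc (distinct-upTo-↭ (length w) (ranks w [] w)
        (Unique⇒Distinct (ranks-unique w [] w refl)) (ranks<length w [] w refl) (length-ranks w [] w))))

relabel : Word → ℤ → ℤ
relabel W a = signedLike a (countLt a W)

stGo-distinct : ∀ full pre rest → full ≡ pre ++ rest → Distinct (map ∣_∣ full) →
                stGo full pre rest ≡ map (relabel full) rest
stGo-distinct full pre []         _ _     = refl
stGo-distinct full pre (a ∷ rest) e full! =
  cong₂ _∷_ (cong (signedLike a) (trans (cong (countLt a full ℕ.+_) no-earlier) (ℕₚ.+-identityʳ _)))
    (stGo-distinct full (pre ++ [ a ]) rest (trans e (++-∷-assoc pre a rest)) full!)
  where
  no-earlier : countEq a pre ≡ 0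
  no-earlier = ℕₚ.n≤0⇒n≡0 (ℕₚ.≤-pred (ℕₚ.≤-trans (subst (countEq a pre <_) (cong (countEq a) (sym e)) (countEq-prefix< pre a rest))
                 (subst (_≤ 1) (sym (countEq≡count≡ a full)) (full! ∣ a ∣))))

st-distinct : ∀ w → Distinct (map ∣_∣ w) → st w ≡ map (relabel w) w
st-distinct w = stGo-distinct w [] w refl

module SignedPerm {ρ : Word} (ρ-perm : IsSignedPerm ρ) where

  positive : All (λ a → 1 ≤ ∣ a ∣) ρ
  positive = Allₚ.map⁻ (↭ₚ.All-resp-↭ (↭-sym ρ-perm) (oneTo-positive (length ρ)))

  bounded : All (λ a → ∣ a ∣ ≤ length ρ) ρ
  bounded = Allₚ.map⁻ (↭ₚ.All-resp-↭ (↭-sym ρ-perm) (oneTo-≤ (length ρ)))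

  distinct : Distinct (map ∣_∣ ρ)
  distinct k = subst (_≤ 1) (sym (count-↭ _ ρ-perm)) (oneTo-distinct (length ρ) k)

  relabel-fixes : All (λ a → relabel ρ a ≡ a) ρ
  relabel-fixes = All.zipWith (λ (pos , bd) → fixes _ pos bd) (positive , bounded)
    where
    countLt-ρ : ∀ {k} a → ∣ a ∣ ≡ suc k → k < length ρ → countLt a ρ ≡ k
    countLt-ρ a e k<n = trans (countLt≡count< a ρ)
      (trans (cong (λ j → count< j (map ∣_∣ ρ)) e) (trans (count-↭ _ ρ-perm) (count<-oneTo (length ρ) (ℕₚ.<⇒≤ k<n))))
    fixes : ∀ a → 1 ≤ ∣ a ∣ → ∣ a ∣ ≤ length ρ → relabel ρ a ≡ a
    fixes (+ zero)   () _
    fixes (+ suc k)  _ bd = cong (λ r → + suc r) (countLt-ρ (+ suc k) refl bd)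
    fixes -[1+ k ]   _ bd = cong -[1+_] (countLt-ρ -[1+ k ] refl bd)

  st-fixes : st ρ ≡ ρ
  st-fixes = trans (st-distinct ρ distinct) (Listₚ.map-id-local relabel-fixes)

record AbsMonotoneOn (P : ℤ → Set) (Φ : ℤ → ℤ) : Set where
  field
    <-mono : ∀ {a b} → P a → P b → ∣ a ∣ < ∣ b ∣ → ∣ Φ a ∣ < ∣ Φ b ∣
    ≡-cong : ∀ {a b} → ∣ a ∣ ≡ ∣ b ∣ → ∣ Φ a ∣ ≡ ∣ Φ b ∣

PreservesSign : (ℤ → ℤ) → Set
PreservesSign Φ = ∀ a → isNeg (Φ a) ≡ isNeg a

module _ {P : ℤ → Set} {Φ : ℤ → ℤ} (mono : AbsMonotoneOn P Φ) where
  open AbsMonotoneOn mono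

  <-reflected : ∀ {a b} → P a → P b → ∣ Φ a ∣ < ∣ Φ b ∣ ⇔ ∣ a ∣ < ∣ b ∣
  <-reflected {a} {b} pa pb = mk⇔ to (<-mono pa pb)
    where
    to : ∣ Φ a ∣ < ∣ Φ b ∣ → ∣ a ∣ < ∣ b ∣
    to Φa<Φb with ℕₚ.<-cmp ∣ a ∣ ∣ b ∣
    ... | tri< a<b _ _ = a<b
    ... | tri≈ _ a≈b _ = ⊥-elim (ℕₚ.<-irrefl (≡-cong a≈b) Φa<Φb)
    ... | tri> _ _ b<a = ⊥-elim (ℕₚ.<-asym Φa<Φb (<-mono pb pa b<a))

  ≡-reflected : ∀ {a b} → P a → P b → ∣ Φ a ∣ ≡ ∣ Φ b ∣ ⇔ ∣ a ∣ ≡ ∣ b ∣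
  ≡-reflected {a} {b} pa pb = mk⇔ to ≡-cong
    where
    to : ∣ Φ a ∣ ≡ ∣ Φ b ∣ → ∣ a ∣ ≡ ∣ b ∣
    to Φa≈Φb with ℕₚ.<-cmp ∣ a ∣ ∣ b ∣
    ... | tri< a<b _ _ = ⊥-elim (ℕₚ.<-irrefl Φa≈Φb (<-mono pa pb a<b))
    ... | tri≈ _ a≈b _ = a≈b
    ... | tri> _ _ b<a = ⊥-elim (ℕₚ.<-irrefl (sym Φa≈Φb) (<-mono pb pa b<a))

  countLt-map : ∀ {a} → P a → ∀ v → All P v → countLt (Φ a) (map Φ v) ≡ countLt a v
  countLt-map pa []      []        = refl
  countLt-map {a} pa (b ∷ v) (pb ∷ pv) =
    cong₂ ℕ._+_ (cong 𝟙 (does-⇔ (<-reflected pb pa) (∣ Φ b ∣ ℕ.<? ∣ Φ a ∣) (∣ b ∣ ℕ.<? ∣ a ∣))) (countLt-map pa v pv)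

  countEq-map : ∀ {a} → P a → ∀ v → All P v → countEq (Φ a) (map Φ v) ≡ countEq a v
  countEq-map pa []      []        = refl
  countEq-map {a} pa (b ∷ v) (pb ∷ pv) =
    cong₂ ℕ._+_ (cong 𝟙 (does-⇔ (≡-reflected pb pa) (∣ Φ b ∣ ℕ.≟ ∣ Φ a ∣) (∣ b ∣ ℕ.≟ ∣ a ∣))) (countEq-map pa v pv)

  module _ (sign : PreservesSign Φ) where

    stGo-map : ∀ full pre rest → All P full → All P pre → All P rest →
               stGo (map Φ full) (map Φ pre) (map Φ rest) ≡ stGo full pre rest
    stGo-map full pre []         _     _    _           = refl
    stGo-map full pre (a ∷ rest) Pfull Ppre (pa ∷ Prest) =
      cong₂ _∷_
        (trans (signedLike-sign _ (sign a)) (cong (signedLike a) (cong₂ ℕ._+_ (countLt-map pa full Pfull) (countEq-map pa pre Ppre))))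
        (trans (cong (λ P′ → stGo (map Φ full) P′ (map Φ rest)) (sym (Listₚ.map-++ Φ pre [ a ])))
          (stGo-map full (pre ++ [ a ]) rest Pfull (Allₚ.++⁺ Ppre (pa ∷ [])) Prest))

    st-map : ∀ w → All P w → st (map Φ w) ≡ st w
    st-map w Pw = stGo-map w [] w Pw [] Pw

Occurs : Word → ℤ → Set
Occurs W a = 1 ≤ countEq a W

relabel-monotone : ∀ W → AbsMonotoneOn (Occurs W) (relabel W)
relabel-monotone W = record
  { <-mono = λ {a} {b} a∈W _ a<b → subst₂ _<_ (sym (∣signedLike∣ a _)) (sym (∣signedLike∣ b _))
               (s≤s (ℕₚ.<-≤-trans (ℕₚ.m<m+n _ a∈W) (countLt+countEq≤countLt W a<b)))
  ; ≡-cong = λ {a} {b} a≈b → trans (∣signedLike∣ a _) (trans (cong suc (countLt-cong W a≈b)) (sym (∣signedLike∣ b _)))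
  }

relabel-preservesSign : ∀ W → PreservesSign (relabel W)
relabel-preservesSign W a = isNeg-signedLike a _

occurs-self : ∀ W → All (Occurs W) W
occurs-self W = All.tabulate occurs
  where
  occurs : ∀ {a} → a ∈ W → Occurs W a
  occurs {a} a∈W with P , R , refl ← ∈-∃++ a∈W = ℕₚ.≤-trans (s≤s z≤n) (countEq-prefix< P a R)

infix 4 _⊑_
record _⊑_ (w W : Word) : Set where
  constructor count≤
  field count≡-≤ : ∀ k → count≡ k (map ∣_∣ w) ≤ count≡ k (map ∣_∣ W)
open _⊑_

⊑-refl : ∀ {w} → w ⊑ w
⊑-refl = count≤ λ _ → ℕₚ.≤-refl

⊑-trans : ∀ {u v w} → u ⊑ v → v ⊑ w → u ⊑ w
⊑-trans u⊑v v⊑w = count≤ λ k → ℕₚ.≤-trans (count≡-≤ u⊑v k) (count≡-≤ v⊑w k)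

↭⇒⊑ : ∀ {w W} → map ∣_∣ w ↭ map ∣_∣ W → w ⊑ W
↭⇒⊑ w↭W = count≤ λ k → ℕₚ.≤-reflexive (count-↭ _ w↭W)

∷⁺-⊑ : ∀ {w W} a → w ⊑ W → a ∷ w ⊑ a ∷ W
∷⁺-⊑ a w⊑W = count≤ λ k → ℕₚ.+-monoʳ-≤ (𝟙 (does (∣ a ∣ ℕ.≟ k))) (count≡-≤ w⊑W k)

⊑-∷ : ∀ {w W} b → w ⊑ W → w ⊑ b ∷ W
⊑-∷ b w⊑W = count≤ λ k → ℕₚ.≤-trans (count≡-≤ w⊑W k) (ℕₚ.m≤n+m _ _)

⊑-shift : ∀ {w} y P v → w ⊑ y ∷ P ++ v → w ⊑ P ++ y ∷ v
⊑-shift y P v w⊑ = ⊑-trans w⊑ (↭⇒⊑ (↭ₚ.map⁺ ∣_∣ (↭-sym (↭ₚ.shift y P v))))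

⊑-distinct : ∀ {w W} → w ⊑ W → Distinct (map ∣_∣ W) → Distinct (map ∣_∣ w)
⊑-distinct w⊑W W! k = ℕₚ.≤-trans (count≡-≤ w⊑W k) (W! k)

⊑-All : ∀ {Q : ℕ → Set} {w W} → w ⊑ W → All (Q ∘ ∣_∣) W → All (Q ∘ ∣_∣) w
⊑-All {Q} {w} {W} w⊑W QW = Allₚ.map⁻ (All.tabulate (λ {k} k∈w →
  All.lookup (Allₚ.map⁺ {P = Q} QW) (1≤count≡⇒∈ k (map ∣_∣ W) (ℕₚ.≤-trans (∈⇒1≤count≡ k∈w) (count≡-≤ w⊑W k)))))

⊑-occurs : ∀ {w W} → w ⊑ W → All (Occurs W) w
⊑-occurs {w} {W} w⊑W = All.map occurs (occurs-self w)
  where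
  occurs : ∀ {a} → Occurs w a → Occurs W a
  occurs {a} a∈w = subst (1 ≤_) (sym (countEq≡count≡ a W))
    (ℕₚ.≤-trans (subst (1 ≤_) (countEq≡count≡ a w) a∈w) (count≡-≤ w⊑W ∣ a ∣))

∣shiftL∣ : ∀ m a → ∣ shiftL m a ∣ ≡ ∣ a ∣ ℕ.+ m
∣shiftL∣ m (+ _)    = refl
∣shiftL∣ m -[1+ _ ] = refl

∣shiftW∣ : ∀ m τ → map ∣_∣ (shiftW m τ) ≡ map (ℕ._+ m) (map ∣_∣ τ)
∣shiftW∣ m τ = trans (sym (Listₚ.map-∘ τ)) (trans (Listₚ.map-cong (∣shiftL∣ m) τ) (Listₚ.map-∘ τ))

shiftL-monotone : ∀ m → AbsMonotoneOn (λ _ → ⊤) (shiftL m)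
shiftL-monotone m = record
  { <-mono = λ {a} {b} _ _ a<b → subst₂ _<_ (sym (∣shiftL∣ m a)) (sym (∣shiftL∣ m b)) (ℕₚ.+-monoˡ-< m a<b)
  ; ≡-cong = λ {a} {b} a≈b → trans (∣shiftL∣ m a) (trans (cong (ℕ._+ m) a≈b) (sym (∣shiftL∣ m b)))
  }

shiftL-preservesSign : ∀ m → PreservesSign (shiftL m)
shiftL-preservesSign m (+ _)    = refl
shiftL-preservesSign m -[1+ _ ] = refl

countLt-shiftW : ∀ m c ρ → countLt (shiftL m c) (shiftW m ρ) ≡ countLt c ρ
countLt-shiftW m c ρ = countLt-map (shiftL-monotone m) tt ρ (All.universal (λ _ → tt) ρ)

signedLike-shiftL : ∀ M L c r → signedLike (shiftL M c) (L ℕ.+ r) ≡ shiftL L (signedLike c r)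
signedLike-shiftL M L (+ _)    r = cong (λ t → + suc t) (ℕₚ.+-comm L r)
signedLike-shiftL M L -[1+ _ ] r = cong -[1+_] (ℕₚ.+-comm L r)

shiftL-shiftL : ∀ m n a → shiftL m (shiftL n a) ≡ shiftL (n ℕ.+ m) a
shiftL-shiftL m n (+ x)    = cong +_ (ℕₚ.+-assoc x n m)
shiftL-shiftL m n -[1+ x ] = cong -[1+_] (ℕₚ.+-assoc x n m)

shiftW-shiftW : ∀ m n ρ → shiftW m (shiftW n ρ) ≡ shiftW (n ℕ.+ m) ρ
shiftW-shiftW m n ρ = trans (sym (Listₚ.map-∘ ρ)) (Listₚ.map-cong (shiftL-shiftL m n) ρ)

shiftL-zero : ∀ a → shiftL 0 a ≡ a
shiftL-zero (+ x)    = cong +_ (ℕₚ.+-identityʳ x)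
shiftL-zero -[1+ x ] = cong -[1+_] (ℕₚ.+-identityʳ x)

shiftW-zero : ∀ ρ → shiftW 0 ρ ≡ ρ
shiftW-zero ρ = trans (Listₚ.map-cong shiftL-zero ρ) (Listₚ.map-id ρ)

shiftW-above : ∀ M ρ → All (λ a → 1 ≤ ∣ a ∣) ρ → All (λ b → M < ∣ b ∣) (shiftW M ρ)
shiftW-above M ρ ρ-pos = Allₚ.map⁺ (All.map (λ {a} 1≤a → subst (M <_) (sym (∣shiftL∣ M a)) (ℕₚ.+-monoˡ-≤ M 1≤a)) ρ-pos)

juxtapose-isSignedPerm : ∀ {σ τ} → IsSignedPerm σ → IsSignedPerm τ → IsSignedPerm (σ ++ shiftW (length σ) τ)
juxtapose-isSignedPerm {σ} {τ} σ-perm τ-perm = begin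
  map ∣_∣ (σ ++ shiftW m τ)                         ≡⟨ Listₚ.map-++ ∣_∣ σ (shiftW m τ) ⟩
  map ∣_∣ σ ++ map ∣_∣ (shiftW m τ)                 ≡⟨ cong (map ∣_∣ σ ++_) (∣shiftW∣ m τ) ⟩
  map ∣_∣ σ ++ map (ℕ._+ m) (map ∣_∣ τ)             ↭⟨ ↭ₚ.++⁺ σ-perm (↭ₚ.map⁺ (ℕ._+ m) τ-perm) ⟩
  oneTo m ++ map (ℕ._+ m) (oneTo (length τ))        ≡⟨ sym (oneTo-+ m (length τ)) ⟩
  oneTo (m ℕ.+ length τ)                            ≡⟨ cong (λ n → oneTo (m ℕ.+ n)) (sym (Listₚ.length-map (shiftL m) τ)) ⟩
  oneTo (m ℕ.+ length (shiftW m τ))                 ≡⟨ cong oneTo (sym (Listₚ.length-++ σ)) ⟩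
  oneTo (length (σ ++ shiftW m τ))                  ∎
  where
  m = length σ
  open ↭.PermutationReasoning

countLt-++ : ∀ a u y → countLt a (u ++ y) ≡ countLt a u ℕ.+ countLt a y
countLt-++ a []      y = refl
countLt-++ a (b ∷ u) y =
  trans (cong (𝟙 (does (∣ b ∣ ℕ.<? ∣ a ∣)) ℕ.+_) (countLt-++ a u y)) (sym (ℕₚ.+-assoc (𝟙 (does (∣ b ∣ ℕ.<? ∣ a ∣))) (countLt a u) _))

countLt-above : ∀ a y → All (λ b → ∣ a ∣ ≤ ∣ b ∣) y → countLt a y ≡ 0
countLt-above a []      []         = refl
countLt-above a (b ∷ y) (a≤b ∷ a≤y) =
  cong₂ ℕ._+_ (𝟙-false (∣ b ∣ ℕ.<? ∣ a ∣) (ℕₚ.≤⇒≯ a≤b)) (countLt-above a y a≤y)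

countLt-below : ∀ a u → All (λ b → ∣ b ∣ < ∣ a ∣) u → countLt a u ≡ length u
countLt-below a []      []         = refl
countLt-below a (b ∷ u) (b<a ∷ u<a) = cong₂ ℕ._+_ (𝟙-true (∣ b ∣ ℕ.<? ∣ a ∣) b<a) (countLt-below a u u<a)

countLt-lowerBlock : ∀ M a u y → ∣ a ∣ ≤ M → All (λ b → M < ∣ b ∣) y → countLt a (u ++ y) ≡ countLt a u
countLt-lowerBlock M a u y a≤M M<y =
  trans (countLt-++ a u y) (trans (cong (countLt a u ℕ.+_)
    (countLt-above a y (All.map (λ M<b → ℕₚ.<⇒≤ (ℕₚ.≤-<-trans a≤M M<b)) M<y))) (ℕₚ.+-identityʳ _))

countLt-upperBlock : ∀ M b u y → M < ∣ b ∣ → All (λ a → ∣ a ∣ ≤ M) u → countLt b (u ++ y) ≡ length u ℕ.+ countLt b y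
countLt-upperBlock M b u y M<b u≤M =
  trans (countLt-++ b u y) (cong (ℕ._+ countLt b y) (countLt-below b u (All.map (λ a≤M → ℕₚ.≤-<-trans a≤M M<b) u≤M)))

relabel-juxtapose : ∀ M u v → Distinct (map ∣_∣ u) → All (λ a → ∣ a ∣ ≤ M) u →
                    Distinct (map ∣_∣ v) → All (λ b → 1 ≤ ∣ b ∣) v →
                    let Ψ = relabel (u ++ shiftW M v) in
                    map Ψ u ≡ st u × map Ψ (shiftW M v) ≡ shiftW (length u) (st v)
relabel-juxtapose M u v u! u≤M v! v-pos = lower , upper
  where
  Ψ = relabel (u ++ shiftW M v)
  lower : map Ψ u ≡ st u
  lower = sym (trans (st-distinct u u!) (Listₚ.map-cong-local (All.map (λ {a} a≤M →
            cong (signedLike a) (sym (countLt-lowerBlock M a u (shiftW M v) a≤M (shiftW-above M v v-pos)))) u≤M)))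
  shifted : ∀ {b} → 1 ≤ ∣ b ∣ → Ψ (shiftL M b) ≡ shiftL (length u) (relabel v b)
  shifted {b} 1≤b = begin
    signedLike (shiftL M b) (countLt (shiftL M b) (u ++ shiftW M v))
      ≡⟨ cong (signedLike (shiftL M b)) (countLt-upperBlock M (shiftL M b) u (shiftW M v) M<b u≤M) ⟩
    signedLike (shiftL M b) (length u ℕ.+ countLt (shiftL M b) (shiftW M v))
      ≡⟨ cong (λ r → signedLike (shiftL M b) (length u ℕ.+ r)) (countLt-shiftW M b v) ⟩
    signedLike (shiftL M b) (length u ℕ.+ countLt b v)
      ≡⟨ signedLike-shiftL M (length u) b (countLt b v) ⟩
    shiftL (length u) (relabel v b) ∎
    where
    open ≡-Reasoning
    M<b : M < ∣ shiftL M b ∣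
    M<b = subst (M <_) (sym (∣shiftL∣ M b)) (ℕₚ.+-monoˡ-≤ M 1≤b)
  upper : map Ψ (shiftW M v) ≡ shiftW (length u) (st v)
  upper = begin
    map Ψ (shiftW M v)                      ≡⟨ sym (Listₚ.map-∘ v) ⟩
    map (Ψ ∘ shiftL M) v                    ≡⟨ Listₚ.map-cong-local (All.map shifted v-pos) ⟩
    map (shiftL (length u) ∘ relabel v) v   ≡⟨ Listₚ.map-∘ v ⟩
    shiftW (length u) (map (relabel v) v)   ≡⟨ cong (shiftW (length u)) (sym (st-distinct v v!)) ⟩
    shiftW (length u) (st v)                ∎
    where open ≡-Reasoning

module _ {c ℓ : Level} (K : CommutativeRing c ℓ) (lam : CommutativeRing.Carrier K) where

  open CommutativeRing K
    using (_≈_; _+_; _*_; -_; 0#; 1#; setoid; +-cong; +-congˡ; +-congʳ; *-cong; *-congˡ; *-congʳ;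
           +-assoc; *-assoc; +-comm; +-identityˡ; +-identityʳ; *-identityˡ; *-identityʳ; distribˡ;
           zeroˡ; zeroʳ; -‿inverseʳ; ring; reflexive)
    renaming (Carrier to R; refl to ≈-refl; sym to ≈-sym; trans to ≈-trans)
  open HSymDefs K lam
  open import Algebra.Solver.Ring.NaturalCoefficients.Default (CommutativeRing.commutativeSemiring K)
    using (solve; _:=_; _:+_; _:*_)
  open import Algebra.Properties.Ring ring using (-1*x≈-x)
  open import Relation.Binary.Reasoning.Setoid setoid

  eval : (Word → R) → LC → R
  eval g []            = 0#
  eval g ((k , w) ∷ x) = k * g w + eval g x

  eval-++ : ∀ g x y → eval g (x ++ y) ≈ eval g x + eval g y
  eval-++ g []      y = ≈-sym (+-identityˡ _)
  eval-++ g (p ∷ x) y = ≈-trans (+-congˡ (eval-++ g x y)) (≈-sym (+-assoc _ _ _))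

  eval-· : ∀ g k x → eval g (k · x) ≈ k * eval g x
  eval-· g k []      = ≈-sym (zeroʳ k)
  eval-· g k (p ∷ x) = ≈-trans (+-cong (*-assoc _ _ _) (eval-· g k x)) (≈-sym (distribˡ k _ _))

  eval-mapWords : ∀ g (f : Word → Word) x → eval g (map (λ p → (proj₁ p , f (proj₂ p))) x) ≡ eval (g ∘ f) x
  eval-mapWords g f []      = refl
  eval-mapWords g f (p ∷ x) = cong (λ t → proj₁ p * g (f (proj₂ p)) + t) (eval-mapWords g f x)

  eval-pre : ∀ g a x → eval g (pre a x) ≡ eval (g ∘ (a ∷_)) x
  eval-pre g a = eval-mapWords g (a ∷_)

  eval-cong : ∀ {g g′} x → (∀ w → g w ≈ g′ w) → eval g x ≈ eval g′ x
  eval-cong []      _  = ≈-refl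
  eval-cong (p ∷ x) eq = +-cong (*-congˡ (eq (proj₂ p))) (eval-cong x eq)

  eval-congᴬ : ∀ {g g′} x → All (λ p → g (proj₂ p) ≈ g′ (proj₂ p)) x → eval g x ≈ eval g′ x
  eval-congᴬ []      []         = ≈-refl
  eval-congᴬ (p ∷ x) (eq ∷ eqs) = +-cong (*-congˡ eq) (eval-congᴬ x eqs)

  eval-+ : ∀ g g′ x → eval (λ w → g w + g′ w) x ≈ eval g x + eval g′ x
  eval-+ g g′ []            = ≈-sym (+-identityˡ _)
  eval-+ g g′ ((k , w) ∷ x) = ≈-trans (+-congˡ (eval-+ g g′ x)) (solve 5
    (λ k a b s t → (k :* (a :+ b) :+ (s :+ t)) := ((k :* a :+ s) :+ (k :* b :+ t))) ≈-refl k (g w) (g′ w) _ _)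

  eval-* : ∀ k g x → eval (λ w → k * g w) x ≈ k * eval g x
  eval-* k g []             = ≈-sym (zeroʳ k)
  eval-* k g ((k′ , w) ∷ x) = ≈-trans (+-congˡ (eval-* k g x)) (solve 4
    (λ k k′ a s → (k′ :* (k :* a) :+ k :* s) := (k :* (k′ :* a :+ s))) ≈-refl k k′ (g w) _)

  eval-zero : ∀ x → eval (λ _ → 0#) x ≈ 0#
  eval-zero []      = ≈-refl
  eval-zero (p ∷ x) = ≈-trans (+-cong (zeroʳ _) (eval-zero x)) (+-identityˡ _)

  eval-swap : ∀ (h : Word → Word → R) x y → eval (λ u → eval (h u) y) x ≈ eval (λ v → eval (λ u → h u v) x) y
  eval-swap h []            y = ≈-sym (eval-zero y)
  eval-swap h ((k , u) ∷ x) y = begin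
    k * eval (h u) y + eval (λ u → eval (h u) y) x             ≈⟨ +-cong (≈-sym (eval-* k (h u) y)) (eval-swap h x y) ⟩
    eval (λ v → k * h u v) y + eval (λ v → eval (λ u → h u v) x) y ≈⟨ ≈-sym (eval-+ _ _ y) ⟩
    eval (λ v → k * h u v + eval (λ u → h u v) x) y             ∎

  eval-⋆̄ : ∀ g x y → eval g (x ⋆̄ y) ≈ eval (λ u → eval (λ v → eval g (shqshW u v)) y) x
  eval-⋆̄ g []            y = ≈-refl
  eval-⋆̄ g ((k , u) ∷ x) y = ≈-trans (eval-++ g (row y) (x ⋆̄ y)) (+-cong (eval-row y) (eval-⋆̄ g x y))
    where
    row : LC → LC
    row = concatMap (λ q → (k * proj₁ q) · shqshW u (proj₂ q))
    eval-row : ∀ y → eval g (row y) ≈ k * eval (λ v → eval g (shqshW u v)) y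
    eval-row []             = ≈-sym (zeroʳ k)
    eval-row ((k′ , v) ∷ y) = begin
      eval g ((k * k′) · shqshW u v ++ row y)                            ≈⟨ eval-++ g ((k * k′) · shqshW u v) (row y) ⟩
      eval g ((k * k′) · shqshW u v) + eval g (row y)                    ≈⟨ +-cong (eval-· g (k * k′) (shqshW u v)) (eval-row y) ⟩
      k * k′ * eval g (shqshW u v) + k * eval (λ v → eval g (shqshW u v)) y
        ≈⟨ solve 4 (λ k k′ a s → (k :* k′ :* a :+ k :* s) := (k :* (k′ :* a :+ s))) ≈-refl k k′ _ _ ⟩
      k * (k′ * eval g (shqshW u v) + eval (λ v → eval g (shqshW u v)) y) ∎

  δ : Word → Word → R
  δ w u = if does (≡-dec ℤ._≟_ u w) then 1# else 0#

  δ-self : ∀ u → δ u u ≈ 1#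
  δ-self u = reflexive (cong (λ b → if b then 1# else 0#) (dec-true (≡-dec ℤ._≟_ u u) refl))

  δ-other : ∀ {u w} → u ≢ w → δ w u ≈ 0#
  δ-other {u} {w} u≢w = reflexive (cong (λ b → if b then 1# else 0#) (dec-false (≡-dec ℤ._≟_ u w) u≢w))

  coeff≈eval-δ : ∀ w x → coeff w x ≈ eval (δ w) x
  coeff≈eval-δ w []            = ≈-refl
  coeff≈eval-δ w ((k , u) ∷ x) = +-cong (select (does (≡-dec ℤ._≟_ u w))) (coeff≈eval-δ w x)
    where
    select : ∀ b → (if b then k else 0#) ≈ k * (if b then 1# else 0#)
    select true  = ≈-sym (*-identityʳ k)
    select false = ≈-sym (zeroʳ k)

  without : Word → LC → LC
  without u []             = []
  without u ((k , u′) ∷ z) = if does (≡-dec ℤ._≟_ u′ u) then without u z else (k , u′) ∷ without u z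

  length-without : ∀ u z → length (without u z) ≤ length z
  length-without u []             = z≤n
  length-without u ((k , u′) ∷ z) with ≡-dec ℤ._≟_ u′ u
  ... | yes _ = ℕₚ.m≤n⇒m≤1+n (length-without u z)
  ... | no _  = s≤s (length-without u z)

  eval-without : ∀ g u z → eval g z ≈ eval (δ u) z * g u + eval g (without u z)
  eval-without g u []             = ≈-sym (≈-trans (+-identityʳ _) (zeroˡ _))
  eval-without g u ((k , u′) ∷ z) with ≡-dec ℤ._≟_ u′ u
  ... | yes refl = begin
    k * g u + eval g z                                    ≈⟨ +-congˡ (eval-without g u z) ⟩
    k * g u + (eval (δ u) z * g u + eval g (without u z)) ≈⟨ solve 4 (λ k a d s → k :* a :+ (d :* a :+ s) := (k :+ d) :* a :+ s) ≈-refl k (g u) _ _ ⟩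
    (k + eval (δ u) z) * g u + eval g (without u z)       ≈⟨ +-congʳ (*-congʳ (+-congʳ (≈-sym (*-identityʳ k)))) ⟩
    (k * 1# + eval (δ u) z) * g u + eval g (without u z)  ∎
  ... | no u′≢u  = begin
    k * g u′ + eval g z                                   ≈⟨ +-congˡ (eval-without g u z) ⟩
    k * g u′ + (eval (δ u) z * g u + eval g (without u z)) ≈⟨ solve 4 (λ k b d s → k :* b :+ (d :+ s) := d :+ (k :* b :+ s)) ≈-refl k (g u′) _ _ ⟩
    eval (δ u) z * g u + (k * g u′ + eval g (without u z)) ≈⟨ +-congʳ (*-congʳ (≈-sym (≈-trans (+-congʳ (zeroʳ k)) (+-identityˡ _)))) ⟩
    (k * 0# + eval (δ u) z) * g u + (k * g u′ + eval g (without u z)) ∎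

  eval-δ-without : ∀ u z → eval (δ u) (without u z) ≈ 0#
  eval-δ-without u []             = ≈-refl
  eval-δ-without u ((k , u′) ∷ z) with ≡-dec ℤ._≟_ u′ u
  ... | yes refl = eval-δ-without u z
  ... | no u′≢u  = ≈-trans (+-cong (≈-trans (*-congˡ (δ-other u′≢u)) (zeroʳ k)) (eval-δ-without u z)) (+-identityˡ _)

  eval-vanishes : ∀ n z → length z ≤ n → (∀ w → eval (δ w) z ≈ 0#) → ∀ g → eval g z ≈ 0#
  eval-vanishes n       []             _          _     g = ≈-refl
  eval-vanishes zero    (_ ∷ _)        ()         _     g
  eval-vanishes (suc n) ((k , u) ∷ z) (s≤s len) δ-zero g = begin
    k * g u + eval g z                                       ≈⟨ +-congˡ (eval-without g u z) ⟩
    k * g u + (eval (δ u) z * g u + eval g (without u z))    ≈⟨ solve 4 (λ k a d s → k :* a :+ (d :* a :+ s) := (k :+ d) :* a :+ s) ≈-refl k (g u) _ _ ⟩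
    (k + eval (δ u) z) * g u + eval g (without u z)          ≈⟨ +-cong (≈-trans (*-congʳ coefficient-u) (zeroˡ _)) rest-vanishes ⟩
    0# + 0#                                                  ≈⟨ +-identityˡ 0# ⟩
    0#                                                       ∎
    where
    coefficient-u : k + eval (δ u) z ≈ 0#
    coefficient-u = ≈-trans (+-congʳ (≈-sym (≈-trans (*-congˡ (δ-self u)) (*-identityʳ k)))) (δ-zero u)
    δ-without : ∀ w → eval (δ w) (without u z) ≈ 0#
    δ-without w = split (≡-dec ℤ._≟_ u w)
      where
      split : Dec (u ≡ w) → eval (δ w) (without u z) ≈ 0#
      split (yes refl) = eval-δ-without u z
      split (no u≢w)   = begin
        eval (δ w) (without u z)                                  ≈⟨ ≈-sym (+-identityˡ _) ⟩
        0# + eval (δ w) (without u z)                             ≈⟨ +-congʳ (≈-sym (≈-trans (*-congˡ (δ-other u≢w)) (zeroʳ _))) ⟩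
        eval (δ u) z * δ w u + eval (δ w) (without u z)           ≈⟨ ≈-sym (eval-without (δ w) u z) ⟩
        eval (δ w) z                                              ≈⟨ ≈-sym (≈-trans (+-congʳ (≈-trans (*-congˡ (δ-other u≢w)) (zeroʳ k))) (+-identityˡ _)) ⟩
        k * δ w u + eval (δ w) z                                  ≈⟨ δ-zero w ⟩
        0#                                                        ∎
    rest-vanishes : eval g (without u z) ≈ 0#
    rest-vanishes = eval-vanishes n (without u z) (ℕₚ.≤-trans (length-without u z) len) δ-without g

  infix 4 _≃_
  _≃_ : LC → LC → Set (c ⊔ ℓ)
  x ≃ y = ∀ g → eval g x ≈ eval g y

  ≃⇒≈ᴸ : ∀ x y → x ≃ y → x ≈ᴸ y
  ≃⇒≈ᴸ x y x≃y w = ≈-trans (coeff≈eval-δ w x) (≈-trans (x≃y (δ w)) (≈-sym (coeff≈eval-δ w y)))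

  +-1*-cancel : ∀ a → a + - 1# * a ≈ 0#
  +-1*-cancel a = ≈-trans (+-congˡ (-1*x≈-x a)) (-‿inverseʳ a)

  ≈ᴸ⇒≃ : ∀ x y → x ≈ᴸ y → x ≃ y
  ≈ᴸ⇒≃ x y x≈y g = begin
    eval g x
      ≈⟨ ≈-sym (≈-trans (+-assoc _ _ _) (≈-trans (+-congˡ (≈-trans (+-comm _ _) (+-1*-cancel _))) (+-identityʳ _))) ⟩
    eval g x + - 1# * eval g y + eval g y   ≈⟨ +-congʳ (≈-sym difference) ⟩
    eval g (x ++ (- 1#) · y) + eval g y     ≈⟨ +-congʳ (eval-vanishes _ (x ++ (- 1#) · y) ℕₚ.≤-refl δ-difference g) ⟩
    0# + eval g y                           ≈⟨ +-identityˡ _ ⟩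
    eval g y                                ∎
    where
    difference : ∀ {g} → eval g (x ++ (- 1#) · y) ≈ eval g x + - 1# * eval g y
    difference {g} = ≈-trans (eval-++ g x _) (+-congˡ (eval-· g (- 1#) y))
    δ-difference : ∀ w → eval (δ w) (x ++ (- 1#) · y) ≈ 0#
    δ-difference w = begin
      eval (δ w) (x ++ (- 1#) · y)                  ≈⟨ difference ⟩
      eval (δ w) x + - 1# * eval (δ w) y            ≈⟨ +-congʳ (≈-trans (≈-sym (coeff≈eval-δ w x)) (≈-trans (x≈y w) (coeff≈eval-δ w y))) ⟩
      eval (δ w) y + - 1# * eval (δ w) y            ≈⟨ +-1*-cancel (eval (δ w) y) ⟩
      0#                                            ∎

  μ : ℤ → ℤ → R
  μ a b = if isNeg a ∧ isNeg b then lam else 0#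

  eval-single : ∀ g w → eval g ((1# , w) ∷ []) ≈ g w
  eval-single g w = ≈-trans (+-identityʳ _) (*-identityˡ (g w))

  eval-qsh-[]ʳ : ∀ g u → eval g (qsh u []) ≈ g u
  eval-qsh-[]ʳ g []      = eval-single g []
  eval-qsh-[]ʳ g (x ∷ u) = eval-single g (x ∷ u)

  eval-qsh-∷∷ : ∀ g x u y v → eval g (qsh (x ∷ u) (y ∷ v)) ≈
    eval (g ∘ (x ∷_)) (qsh u (y ∷ v)) + eval (g ∘ (y ∷_)) (qsh (x ∷ u) v) + μ x y * eval (g ∘ (x ∷_)) (qsh u v)
  eval-qsh-∷∷ g x u y v = begin
    eval g (pre x (qsh u (y ∷ v)) ++ pre y (qsh (x ∷ u) v) ++ merged (isNeg x ∧ isNeg y))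
      ≈⟨ eval-++ g (pre x (qsh u (y ∷ v))) (pre y (qsh (x ∷ u) v) ++ merged (isNeg x ∧ isNeg y)) ⟩
    eval g (pre x (qsh u (y ∷ v))) + eval g (pre y (qsh (x ∷ u) v) ++ merged (isNeg x ∧ isNeg y))
      ≈⟨ +-cong (reflexive (eval-pre g x (qsh u (y ∷ v))))
           (≈-trans (eval-++ g (pre y (qsh (x ∷ u) v)) (merged (isNeg x ∧ isNeg y)))
             (+-cong (reflexive (eval-pre g y (qsh (x ∷ u) v))) (eval-merged (isNeg x ∧ isNeg y)))) ⟩
    eval (g ∘ (x ∷_)) (qsh u (y ∷ v)) + (eval (g ∘ (y ∷_)) (qsh (x ∷ u) v) + μ x y * eval (g ∘ (x ∷_)) (qsh u v))
      ≈⟨ ≈-sym (+-assoc _ _ _) ⟩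
    eval (g ∘ (x ∷_)) (qsh u (y ∷ v)) + eval (g ∘ (y ∷_)) (qsh (x ∷ u) v) + μ x y * eval (g ∘ (x ∷_)) (qsh u v) ∎
    where
    merged : Bool → LC
    merged b = if b then lam · pre x (qsh u v) else []
    eval-merged : ∀ b → eval g (merged b) ≈ (if b then lam else 0#) * eval (g ∘ (x ∷_)) (qsh u v)
    eval-merged true  = ≈-trans (eval-· g lam (pre x (qsh u v))) (*-congˡ (reflexive (eval-pre g x (qsh u v))))
    eval-merged false = ≈-sym (zeroˡ _)

  eval-qsh-map : ∀ {Φ} → PreservesSign Φ → ∀ g u v → eval g (qsh (map Φ u) (map Φ v)) ≈ eval (g ∘ map Φ) (qsh u v)
  eval-qsh-map sign g []      v       = ≈-refl
  eval-qsh-map sign g (x ∷ u) []      = ≈-refl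
  eval-qsh-map {Φ} sign g (x ∷ u) (y ∷ v) = begin
    eval g (qsh (Φ x ∷ map Φ u) (Φ y ∷ map Φ v))
      ≈⟨ eval-qsh-∷∷ g (Φ x) (map Φ u) (Φ y) (map Φ v) ⟩
    eval (g ∘ (Φ x ∷_)) (qsh (map Φ u) (Φ y ∷ map Φ v)) + eval (g ∘ (Φ y ∷_)) (qsh (Φ x ∷ map Φ u) (map Φ v))
      + μ (Φ x) (Φ y) * eval (g ∘ (Φ x ∷_)) (qsh (map Φ u) (map Φ v))
      ≈⟨ +-cong (+-cong (eval-qsh-map sign _ u (y ∷ v)) (eval-qsh-map sign _ (x ∷ u) v))
           (*-cong (reflexive (cong₂ (λ a b → if a ∧ b then lam else 0#) (sign x) (sign y))) (eval-qsh-map sign _ u v)) ⟩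
    eval (g ∘ map Φ ∘ (x ∷_)) (qsh u (y ∷ v)) + eval (g ∘ map Φ ∘ (y ∷_)) (qsh (x ∷ u) v) + μ x y * eval (g ∘ map Φ ∘ (x ∷_)) (qsh u v)
      ≈⟨ ≈-sym (eval-qsh-∷∷ (g ∘ map Φ) x u y v) ⟩
    eval (g ∘ map Φ) (qsh (x ∷ u) (y ∷ v)) ∎

  eval-linear₃ : ∀ {f f₁ f₂ f₃ : Word → R} m X → (∀ t → f t ≈ f₁ t + f₂ t + m * f₃ t) →
                 eval f X ≈ eval f₁ X + eval f₂ X + m * eval f₃ X
  eval-linear₃ {f₁ = f₁} {f₂} {f₃} m X eq =
    ≈-trans (eval-cong X eq) (≈-trans (eval-+ _ _ X) (+-cong (eval-+ f₁ f₂ X) (eval-* m f₃ X)))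

  evalˡ evalʳ : (Word → R) → Word → Word → Word → R
  evalˡ g a b c = eval (λ w → eval g (qsh w c)) (qsh a b)
  evalʳ g a b c = eval (λ w → eval g (qsh a w)) (qsh b c)

  -- The seven ways the first letter of a term of a triple product arises: from one factor, or merged from several.
  expansion : ((Word → R) → Word → Word → Word → R) → (Word → R) → ℤ → Word → ℤ → Word → ℤ → Word → R
  expansion F g x u y v z w =
    F (g ∘ (x ∷_)) u (y ∷ v) (z ∷ w) + F (g ∘ (y ∷_)) (x ∷ u) v (z ∷ w) + F (g ∘ (z ∷_)) (x ∷ u) (y ∷ v) w
    + μ x y * F (g ∘ (x ∷_)) u v (z ∷ w) + μ x z * F (g ∘ (x ∷_)) u (y ∷ v) w
    + μ y z * F (g ∘ (y ∷_)) (x ∷ u) v w + μ x y * μ x z * F (g ∘ (x ∷_)) u v w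

  evalˡ-∷ : ∀ g x u y v z w → evalˡ g (x ∷ u) (y ∷ v) (z ∷ w) ≈ expansion evalˡ g x u y v z w
  evalˡ-∷ g x u y v z w = begin
    evalˡ g A B C
      ≈⟨ eval-qsh-∷∷ h x u y v ⟩
    eval (h ∘ (x ∷_)) (qsh u B) + eval (h ∘ (y ∷_)) (qsh A v) + μ x y * eval (h ∘ (x ∷_)) (qsh u v)
      ≈⟨ +-cong (+-cong (unfold x (qsh u B)) (unfold y (qsh A v))) (*-congˡ (unfold x (qsh u v))) ⟩
    (a₁ + z₁ + μ x z * a₂) + (a₃ + z₂ + μ y z * a₄) + μ x y * (a₅ + z₃ + μ x z * a₆)
      ≈⟨ solve 12 (λ a₁ z₁ a₂ a₃ z₂ a₄ a₅ z₃ a₆ μxy μxz μyz →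
           (a₁ :+ z₁ :+ μxz :* a₂) :+ (a₃ :+ z₂ :+ μyz :* a₄) :+ μxy :* (a₅ :+ z₃ :+ μxz :* a₆)
           := a₁ :+ a₃ :+ (z₁ :+ z₂ :+ μxy :* z₃) :+ μxy :* a₅ :+ μxz :* a₂ :+ μyz :* a₄ :+ μxy :* μxz :* a₆)
           ≈-refl a₁ z₁ a₂ a₃ z₂ a₄ a₅ z₃ a₆ (μ x y) (μ x z) (μ y z) ⟩
    a₁ + a₃ + (z₁ + z₂ + μ x y * z₃) + μ x y * a₅ + μ x z * a₂ + μ y z * a₄ + μ x y * μ x z * a₆
      ≈⟨ +-congʳ (+-congʳ (+-congʳ (+-congʳ (+-congˡ (≈-sym (eval-qsh-∷∷ (λ t → eval (g ∘ (z ∷_)) (qsh t w)) x u y v)))))) ⟩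
    expansion evalˡ g x u y v z w ∎
    where
    A = x ∷ u
    B = y ∷ v
    C = z ∷ w
    h : Word → R
    h t = eval g (qsh t C)
    unfold : ∀ a X → eval (h ∘ (a ∷_)) X ≈ eval (λ t → eval (g ∘ (a ∷_)) (qsh t C)) X
                                          + eval (λ t → eval (g ∘ (z ∷_)) (qsh (a ∷ t) w)) X + μ a z * eval (λ t → eval (g ∘ (a ∷_)) (qsh t w)) X
    unfold a X = eval-linear₃ (μ a z) X (λ t → eval-qsh-∷∷ g a t z w)
    a₁ = evalˡ (g ∘ (x ∷_)) u B C
    a₂ = evalˡ (g ∘ (x ∷_)) u B w
    a₃ = evalˡ (g ∘ (y ∷_)) A v C
    a₄ = evalˡ (g ∘ (y ∷_)) A v w
    a₅ = evalˡ (g ∘ (x ∷_)) u v C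
    a₆ = evalˡ (g ∘ (x ∷_)) u v w
    z₁ = eval (λ t → eval (g ∘ (z ∷_)) (qsh (x ∷ t) w)) (qsh u B)
    z₂ = eval (λ t → eval (g ∘ (z ∷_)) (qsh (y ∷ t) w)) (qsh A v)
    z₃ = eval (λ t → eval (g ∘ (z ∷_)) (qsh (x ∷ t) w)) (qsh u v)

  μ-swap : ∀ x y z → μ y z * μ x y ≈ μ x y * μ x z
  μ-swap x y z = swap (isNeg x) (isNeg y) (isNeg z)
    where
    m : Bool → R
    m b = if b then lam else 0#
    swap : ∀ bx by bz → m (by ∧ bz) * m (bx ∧ by) ≈ m (bx ∧ by) * m (bx ∧ bz)
    swap true  true  true  = ≈-refl
    swap true  true  false = ≈-trans (zeroˡ _) (≈-sym (zeroʳ _))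
    swap true  false _     = ≈-trans (zeroˡ _) (≈-sym (zeroˡ _))
    swap false _     _     = ≈-trans (zeroʳ _) (≈-sym (zeroˡ _))

  evalʳ-∷ : ∀ g x u y v z w → evalʳ g (x ∷ u) (y ∷ v) (z ∷ w) ≈ expansion evalʳ g x u y v z w
  evalʳ-∷ g x u y v z w = begin
    evalʳ g A B C
      ≈⟨ eval-qsh-∷∷ k y v z w ⟩
    eval (k ∘ (y ∷_)) (qsh v C) + eval (k ∘ (z ∷_)) (qsh B w) + μ y z * eval (k ∘ (y ∷_)) (qsh v w)
      ≈⟨ +-cong (+-cong (unfold y (qsh v C)) (unfold z (qsh B w))) (*-congˡ (unfold y (qsh v w))) ⟩
    (x₁ + b₃ + μ x y * b₅) + (x₂ + b₇ + μ x z * b₂) + μ y z * (x₃ + b₄ + μ x y * b₆)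
      ≈⟨ solve 12 (λ x₁ b₃ b₅ x₂ b₇ b₂ x₃ b₄ b₆ μxy μxz μyz →
           (x₁ :+ b₃ :+ μxy :* b₅) :+ (x₂ :+ b₇ :+ μxz :* b₂) :+ μyz :* (x₃ :+ b₄ :+ μxy :* b₆)
           := (x₁ :+ x₂ :+ μyz :* x₃) :+ b₃ :+ b₇ :+ μxy :* b₅ :+ μxz :* b₂ :+ μyz :* b₄ :+ μyz :* μxy :* b₆)
           ≈-refl x₁ b₃ b₅ x₂ b₇ b₂ x₃ b₄ b₆ (μ x y) (μ x z) (μ y z) ⟩
    (x₁ + x₂ + μ y z * x₃) + b₃ + b₇ + μ x y * b₅ + μ x z * b₂ + μ y z * b₄ + μ y z * μ x y * b₆
      ≈⟨ +-cong (+-congʳ (+-congʳ (+-congʳ (+-congʳ (+-congʳ (≈-sym (eval-qsh-∷∷ (λ t → eval (g ∘ (x ∷_)) (qsh u t)) y v z w)))))))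
                (*-congʳ (μ-swap x y z)) ⟩
    expansion evalʳ g x u y v z w ∎
    where
    A = x ∷ u
    B = y ∷ v
    C = z ∷ w
    k : Word → R
    k t = eval g (qsh A t)
    unfold : ∀ a X → eval (k ∘ (a ∷_)) X ≈ eval (λ t → eval (g ∘ (x ∷_)) (qsh u (a ∷ t))) X
                                          + eval (λ t → eval (g ∘ (a ∷_)) (qsh A t)) X + μ x a * eval (λ t → eval (g ∘ (x ∷_)) (qsh u t)) X
    unfold a X = eval-linear₃ (μ x a) X (λ t → eval-qsh-∷∷ g x u a t)
    x₁ = eval (λ t → eval (g ∘ (x ∷_)) (qsh u (y ∷ t))) (qsh v C)
    x₂ = eval (λ t → eval (g ∘ (x ∷_)) (qsh u (z ∷ t))) (qsh B w)
    x₃ = eval (λ t → eval (g ∘ (x ∷_)) (qsh u (y ∷ t))) (qsh v w)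
    b₂ = evalʳ (g ∘ (x ∷_)) u B w
    b₃ = evalʳ (g ∘ (y ∷_)) A v C
    b₄ = evalʳ (g ∘ (y ∷_)) A v w
    b₅ = evalʳ (g ∘ (x ∷_)) u v C
    b₆ = evalʳ (g ∘ (x ∷_)) u v w
    b₇ = evalʳ (g ∘ (z ∷_)) A B w

  qsh-assoc : ∀ g a b c → evalˡ g a b c ≈ evalʳ g a b c
  qsh-assoc g []      b       c       = ≈-trans (eval-single (λ w → eval g (qsh w c)) b) (eval-cong (qsh b c) (λ w → ≈-sym (eval-single g w)))
  qsh-assoc g (x ∷ u) []      c       = ≈-refl
  qsh-assoc g (x ∷ u) (y ∷ v) []      =
    ≈-trans (eval-cong (qsh (x ∷ u) (y ∷ v)) (eval-qsh-[]ʳ g)) (≈-sym (eval-single (λ w → eval g (qsh (x ∷ u) w)) (y ∷ v)))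
  qsh-assoc g (x ∷ u) (y ∷ v) (z ∷ w) = begin
    evalˡ g (x ∷ u) (y ∷ v) (z ∷ w)   ≈⟨ evalˡ-∷ g x u y v z w ⟩
    expansion evalˡ g x u y v z w     ≈⟨ +-cong (+-cong (+-cong (+-cong (+-cong (+-cong
                                           (qsh-assoc (g ∘ (x ∷_)) u (y ∷ v) (z ∷ w))
                                           (qsh-assoc (g ∘ (y ∷_)) (x ∷ u) v (z ∷ w)))
                                           (qsh-assoc (g ∘ (z ∷_)) (x ∷ u) (y ∷ v) w))
                                           (*-congˡ (qsh-assoc (g ∘ (x ∷_)) u v (z ∷ w))))
                                           (*-congˡ (qsh-assoc (g ∘ (x ∷_)) u (y ∷ v) w)))
                                           (*-congˡ (qsh-assoc (g ∘ (y ∷_)) (x ∷ u) v w)))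
                                           (*-congˡ (qsh-assoc (g ∘ (x ∷_)) u v w)) ⟩
    expansion evalʳ g x u y v z w     ≈⟨ ≈-sym (evalʳ-∷ g x u y v z w) ⟩
    evalʳ g (x ∷ u) (y ∷ v) (z ∷ w)   ∎

  qsh-support : ∀ u v → All (λ p → proj₂ p ⊑ u ++ v) (qsh u v)
  qsh-support []      v       = ⊑-refl ∷ []
  qsh-support (x ∷ u) []      = subst (x ∷ u ⊑_) (sym (Listₚ.++-identityʳ (x ∷ u))) ⊑-refl ∷ []
  qsh-support (x ∷ u) (y ∷ v) =
    Allₚ.++⁺ (Allₚ.map⁺ (All.map (∷⁺-⊑ x) (qsh-support u (y ∷ v))))
      (Allₚ.++⁺ (Allₚ.map⁺ (All.map (λ w⊑ → ⊑-shift y (x ∷ u) v (∷⁺-⊑ y w⊑)) (qsh-support (x ∷ u) v)))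
        (merged (isNeg x ∧ isNeg y)))
    where
    merged : ∀ b → All (λ p → proj₂ p ⊑ x ∷ u ++ y ∷ v) (if b then lam · pre x (qsh u v) else [])
    merged true  = Allₚ.map⁺ (Allₚ.map⁺ (All.map (λ w⊑ → ∷⁺-⊑ x (⊑-shift y u v (⊑-∷ y w⊑))) (qsh-support u v)))
    merged false = []

  eval-st-qsh-relabel : ∀ u v h → let Ψ = relabel (u ++ v) in
                        eval (h ∘ st) (qsh (map Ψ u) (map Ψ v)) ≈ eval (h ∘ st) (qsh u v)
  eval-st-qsh-relabel u v h =
    ≈-trans (eval-qsh-map (relabel-preservesSign W) (h ∘ st) u v)
      (eval-congᴬ (qsh u v) (All.map (λ w⊑W → reflexive (cong h (st-map (relabel-monotone W) (relabel-preservesSign W) _ (⊑-occurs w⊑W))))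
                               (qsh-support u v)))
    where W = u ++ v

  eval-shqshW-st : ∀ M u v → Distinct (map ∣_∣ u) → All (λ a → ∣ a ∣ ≤ M) u →
                   Distinct (map ∣_∣ v) → All (λ b → 1 ≤ ∣ b ∣) v → ∀ g →
                   eval g (shqshW (st u) (st v)) ≈ eval (g ∘ st) (qsh u (shiftW M v))
  eval-shqshW-st M u v u! u≤M v! v-pos g = begin
    eval g (shqshW (st u) (st v))                               ≡⟨ eval-mapWords g st (qsh (st u) (shiftW (length (st u)) (st v))) ⟩
    eval (g ∘ st) (qsh (st u) (shiftW (length (st u)) (st v))) ≡⟨ cong₂ (λ a b → eval (g ∘ st) (qsh a b)) (sym st-u) (sym st-v) ⟩
    eval (g ∘ st) (qsh (map Ψ u) (map Ψ (shiftW M v)))          ≈⟨ eval-st-qsh-relabel u (shiftW M v) g ⟩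
    eval (g ∘ st) (qsh u (shiftW M v))                          ∎
    where
    Ψ = relabel (u ++ shiftW M v)
    st-u = proj₁ (relabel-juxtapose M u v u! u≤M v! v-pos)
    st-v = trans (proj₂ (relabel-juxtapose M u v u! u≤M v! v-pos)) (cong (λ n → shiftW n (st v)) (sym (length-st u)))

  eval-shqshW-assoc : ∀ {σ τ ρ} → IsSignedPerm σ → IsSignedPerm τ → IsSignedPerm ρ → ∀ g →
    eval (λ w → eval g (shqshW w ρ)) (shqshW σ τ) ≈ eval (λ w → eval g (shqshW σ w)) (shqshW τ ρ)
  eval-shqshW-assoc {σ} {τ} {ρ} σ-perm τ-perm ρ-perm g = begin
    eval (λ w → eval g (shqshW w ρ)) (shqshW σ τ)
      ≡⟨ eval-mapWords (λ w → eval g (shqshW w ρ)) st (qsh σ (shiftW m τ)) ⟩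
    eval (λ w → eval g (shqshW (st w) ρ)) (qsh σ (shiftW m τ))
      ≈⟨ eval-congᴬ {g′ = λ w → eval (g ∘ st) (qsh w (shiftW (n ℕ.+ m) ρ))} (qsh σ (shiftW m τ))
           (All.map (λ {p} → left {p}) (qsh-support σ (shiftW m τ))) ⟩
    evalˡ (g ∘ st) σ (shiftW m τ) (shiftW (n ℕ.+ m) ρ)
      ≈⟨ qsh-assoc (g ∘ st) σ (shiftW m τ) (shiftW (n ℕ.+ m) ρ) ⟩
    evalʳ (g ∘ st) σ (shiftW m τ) (shiftW (n ℕ.+ m) ρ)
      ≡⟨ cong (evalʳ (g ∘ st) σ (shiftW m τ)) (shiftW-shiftW m n ρ) ⟨
    eval (λ w → eval (g ∘ st) (qsh σ w)) (qsh (map (shiftL m) τ) (map (shiftL m) (shiftW n ρ)))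
      ≈⟨ eval-qsh-map (shiftL-preservesSign m) (λ w → eval (g ∘ st) (qsh σ w)) τ (shiftW n ρ) ⟩
    eval (λ w → eval (g ∘ st) (qsh σ (shiftW m w))) (qsh τ (shiftW n ρ))
      ≈⟨ eval-congᴬ {g = λ w → eval g (shqshW σ (st w))} (qsh τ (shiftW n ρ)) (All.map (λ {p} → right {p}) (qsh-support τ (shiftW n ρ))) ⟨
    eval (λ w → eval g (shqshW σ (st w))) (qsh τ (shiftW n ρ))
      ≡⟨ eval-mapWords (λ w → eval g (shqshW σ w)) st (qsh τ (shiftW n ρ)) ⟨
    eval (λ w → eval g (shqshW σ w)) (shqshW τ ρ) ∎
    where
    m = length σ
    n = length τ
    module σ = SignedPerm σ-perm
    module ρ = SignedPerm ρ-perm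
    module στ = SignedPerm (juxtapose-isSignedPerm σ-perm τ-perm)
    module τρ = SignedPerm (juxtapose-isSignedPerm τ-perm ρ-perm)
    length-στ : length (σ ++ shiftW m τ) ≡ n ℕ.+ m
    length-στ = trans (Listₚ.length-++ σ) (trans (cong (m ℕ.+_) (Listₚ.length-map (shiftL m) τ)) (ℕₚ.+-comm m n))
    left : ∀ {p : R × Word} → proj₂ p ⊑ σ ++ shiftW m τ → eval g (shqshW (st (proj₂ p)) ρ) ≈ eval (g ∘ st) (qsh (proj₂ p) (shiftW (n ℕ.+ m) ρ))
    left {_ , w} w⊑ = subst (λ ρ′ → eval g (shqshW (st w) ρ′) ≈ eval (g ∘ st) (qsh w (shiftW (n ℕ.+ m) ρ))) ρ.st-fixes
      (eval-shqshW-st (n ℕ.+ m) w ρ (⊑-distinct w⊑ στ.distinct)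
        (⊑-All {Q = _≤ n ℕ.+ m} w⊑ (All.map (λ ≤len → ℕₚ.≤-trans ≤len (ℕₚ.≤-reflexive length-στ)) στ.bounded))
        ρ.distinct ρ.positive g)
    right : ∀ {p : R × Word} → proj₂ p ⊑ τ ++ shiftW n ρ → eval g (shqshW σ (st (proj₂ p))) ≈ eval (g ∘ st) (qsh σ (shiftW m (proj₂ p)))
    right {_ , w} w⊑ = subst (λ σ′ → eval g (shqshW σ′ (st w)) ≈ eval (g ∘ st) (qsh σ (shiftW m w))) σ.st-fixes
      (eval-shqshW-st m σ w σ.distinct σ.bounded (⊑-distinct w⊑ τρ.distinct) (⊑-All {Q = 1 ≤_} w⊑ τρ.positive) g)

  ⋆̄-closed : ∀ x y → InHSym (x ⋆̄ y)
  ⋆̄-closed x y = Allₚ.concat⁺ (Allₚ.map⁺ (All.universal (λ p → Allₚ.concat⁺ (Allₚ.map⁺ (All.universal (λ q →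
    Allₚ.map⁺ (Allₚ.map⁺ (All.universal (λ r → st-isSignedPerm (proj₂ r)) _))) y))) x))

  ⋆̄-cong : ∀ x x′ y y′ → x ≃ x′ → y ≃ y′ → x ⋆̄ y ≃ x′ ⋆̄ y′
  ⋆̄-cong x x′ y y′ x≃x′ y≃y′ g = begin
    eval g (x ⋆̄ y)                                              ≈⟨ eval-⋆̄ g x y ⟩
    eval (λ u → eval (λ v → eval g (shqshW u v)) y) x          ≈⟨ eval-cong x (λ u → y≃y′ _) ⟩
    eval (λ u → eval (λ v → eval g (shqshW u v)) y′) x         ≈⟨ x≃x′ _ ⟩
    eval (λ u → eval (λ v → eval g (shqshW u v)) y′) x′        ≈⟨ eval-⋆̄ g x′ y′ ⟨
    eval g (x′ ⋆̄ y′)                                            ∎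

  ⋆̄-distribˡ : ∀ x y z → x ⋆̄ (y ⊕ z) ≃ x ⋆̄ y ⊕ x ⋆̄ z
  ⋆̄-distribˡ x y z g = begin
    eval g (x ⋆̄ (y ++ z))                                        ≈⟨ eval-⋆̄ g x (y ++ z) ⟩
    eval (λ u → eval (λ v → eval g (shqshW u v)) (y ++ z)) x    ≈⟨ eval-cong x (λ u → eval-++ _ y z) ⟩
    eval (λ u → eval (λ v → eval g (shqshW u v)) y + eval (λ v → eval g (shqshW u v)) z) x
                                                                 ≈⟨ eval-+ _ _ x ⟩
    eval (λ u → eval (λ v → eval g (shqshW u v)) y) x + eval (λ u → eval (λ v → eval g (shqshW u v)) z) x
                                                                 ≈⟨ +-cong (eval-⋆̄ g x y) (eval-⋆̄ g x z) ⟨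
    eval g (x ⋆̄ y) + eval g (x ⋆̄ z)                              ≈⟨ eval-++ g (x ⋆̄ y) (x ⋆̄ z) ⟨
    eval g (x ⋆̄ y ++ x ⋆̄ z)                                      ∎

  ⋆̄-distribʳ : ∀ x y z → (x ⊕ y) ⋆̄ z ≃ x ⋆̄ z ⊕ y ⋆̄ z
  ⋆̄-distribʳ x y z g = begin
    eval g ((x ++ y) ⋆̄ z)                                         ≈⟨ eval-⋆̄ g (x ++ y) z ⟩
    eval (λ u → eval (λ v → eval g (shqshW u v)) z) (x ++ y)     ≈⟨ eval-++ _ x y ⟩
    eval (λ u → eval (λ v → eval g (shqshW u v)) z) x + eval (λ u → eval (λ v → eval g (shqshW u v)) z) y
                                                                  ≈⟨ +-cong (eval-⋆̄ g x z) (eval-⋆̄ g y z) ⟨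
    eval g (x ⋆̄ z) + eval g (y ⋆̄ z)                               ≈⟨ eval-++ g (x ⋆̄ z) (y ⋆̄ z) ⟨
    eval g (x ⋆̄ z ++ y ⋆̄ z)                                       ∎

  ⋆̄-scalarˡ : ∀ k x y → (k · x) ⋆̄ y ≃ k · (x ⋆̄ y)
  ⋆̄-scalarˡ k x y g = begin
    eval g ((k · x) ⋆̄ y)                                          ≈⟨ eval-⋆̄ g (k · x) y ⟩
    eval (λ u → eval (λ v → eval g (shqshW u v)) y) (k · x)      ≈⟨ eval-· _ k x ⟩
    k * eval (λ u → eval (λ v → eval g (shqshW u v)) y) x        ≈⟨ *-congˡ (eval-⋆̄ g x y) ⟨
    k * eval g (x ⋆̄ y)                                            ≈⟨ eval-· g k (x ⋆̄ y) ⟨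
    eval g (k · (x ⋆̄ y))                                          ∎

  ⋆̄-scalarʳ : ∀ k x y → x ⋆̄ (k · y) ≃ k · (x ⋆̄ y)
  ⋆̄-scalarʳ k x y g = begin
    eval g (x ⋆̄ (k · y))                                          ≈⟨ eval-⋆̄ g x (k · y) ⟩
    eval (λ u → eval (λ v → eval g (shqshW u v)) (k · y)) x      ≈⟨ eval-cong x (λ u → eval-· _ k y) ⟩
    eval (λ u → k * eval (λ v → eval g (shqshW u v)) y) x        ≈⟨ eval-* k _ x ⟩
    k * eval (λ u → eval (λ v → eval g (shqshW u v)) y) x        ≈⟨ *-congˡ (eval-⋆̄ g x y) ⟨
    k * eval g (x ⋆̄ y)                                            ≈⟨ eval-· g k (x ⋆̄ y) ⟨
    eval g (k · (x ⋆̄ y))                                          ∎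

  ⋆̄-assoc : ∀ x y z → InHSym x → InHSym y → InHSym z → (x ⋆̄ y) ⋆̄ z ≃ x ⋆̄ (y ⋆̄ z)
  ⋆̄-assoc x y z x∈ y∈ z∈ g = begin
    eval g ((x ⋆̄ y) ⋆̄ z)
      ≈⟨ eval-⋆̄ g (x ⋆̄ y) z ⟩
    eval (λ w → eval (G w) z) (x ⋆̄ y)
      ≈⟨ eval-⋆̄ (λ w → eval (G w) z) x y ⟩
    eval (λ a → eval (λ b → eval (λ w → eval (G w) z) (shqshW a b)) y) x
      ≈⟨ eval-cong x (λ a → eval-cong y (λ b → eval-swap G (shqshW a b) z)) ⟩
    eval (λ a → eval (λ b → eval (λ c → eval (λ w → G w c) (shqshW a b)) z) y) x
      ≈⟨ eval-congᴬ x (All.map (λ σ-perm → eval-congᴬ y (All.map (λ τ-perm → eval-congᴬ z (All.map (λ ρ-perm →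
           eval-shqshW-assoc σ-perm τ-perm ρ-perm g) z∈)) y∈)) x∈) ⟩
    eval (λ a → eval (λ b → eval (λ c → eval (G a) (shqshW b c)) z) y) x
      ≈⟨ eval-cong x (λ a → eval-⋆̄ (G a) y z) ⟨
    eval (λ a → eval (G a) (y ⋆̄ z)) x
      ≈⟨ eval-⋆̄ g x (y ⋆̄ z) ⟨
    eval g (x ⋆̄ (y ⋆̄ z)) ∎
    where
    G : Word → Word → R
    G w c = eval g (shqshW w c)

  ⋆̄-identityˡ : ∀ x → InHSym x → unit ⋆̄ x ≃ x
  ⋆̄-identityˡ x x∈ g = begin
    eval g (unit ⋆̄ x)                                    ≈⟨ eval-⋆̄ g unit x ⟩
    eval (λ u → eval (λ v → eval g (shqshW u v)) x) unit ≈⟨ eval-single (λ u → eval (λ v → eval g (shqshW u v)) x) [] ⟩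
    eval (λ v → eval g (shqshW [] v)) x                  ≈⟨ eval-congᴬ x (All.map (λ {p} → left-unit {p}) x∈) ⟩
    eval g x                                             ∎
    where
    left-unit : ∀ {p : R × Word} → IsSignedPerm (proj₂ p) → eval g (shqshW [] (proj₂ p)) ≈ g (proj₂ p)
    left-unit {_ , ρ} ρ-perm = begin
      eval g (shqshW [] ρ)          ≈⟨ eval-single g (st (shiftW 0 ρ)) ⟩
      g (st (shiftW 0 ρ))           ≡⟨ cong (g ∘ st) (shiftW-zero ρ) ⟩
      g (st ρ)                      ≡⟨ cong g (SignedPerm.st-fixes ρ-perm) ⟩
      g ρ                           ∎

  ⋆̄-identityʳ : ∀ x → InHSym x → x ⋆̄ unit ≃ x
  ⋆̄-identityʳ x x∈ g = begin
    eval g (x ⋆̄ unit)                                    ≈⟨ eval-⋆̄ g x unit ⟩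
    eval (λ u → eval (λ v → eval g (shqshW u v)) unit) x ≈⟨ eval-congᴬ x (All.map (λ {p} → right-unit {p}) x∈) ⟩
    eval g x                                             ∎
    where
    right-unit : ∀ {p : R × Word} → IsSignedPerm (proj₂ p) → eval (λ v → eval g (shqshW (proj₂ p) v)) unit ≈ g (proj₂ p)
    right-unit {_ , σ} σ-perm = begin
      eval (λ v → eval g (shqshW σ v)) unit ≈⟨ eval-single (λ v → eval g (shqshW σ v)) [] ⟩
      eval g (shqshW σ [])                  ≡⟨ eval-mapWords g st (qsh σ []) ⟩
      eval (g ∘ st) (qsh σ [])              ≈⟨ eval-qsh-[]ʳ (g ∘ st) σ ⟩
      g (st σ)                              ≡⟨ cong g (SignedPerm.st-fixes σ-perm) ⟩
      g σ                                   ∎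

  hsym-isUnitalAssocAlgebra : IsUnitalAssocAlgebra
  hsym-isUnitalAssocAlgebra = record
    { closed      = λ x y _ _ → ⋆̄-closed x y
    ; unit-in     = ↭.refl ∷ []
    ; ⋆̄-cong      = λ x x′ y y′ _ _ _ _ x≈x′ y≈y′ →
                      ≃⇒≈ᴸ (x ⋆̄ y) (x′ ⋆̄ y′) (⋆̄-cong x x′ y y′ (≈ᴸ⇒≃ x x′ x≈x′) (≈ᴸ⇒≃ y y′ y≈y′))
    ; ⋆̄-distribˡ  = λ x y z _ _ _ → ≃⇒≈ᴸ (x ⋆̄ (y ⊕ z)) (x ⋆̄ y ⊕ x ⋆̄ z) (⋆̄-distribˡ x y z)
    ; ⋆̄-distribʳ  = λ x y z _ _ _ → ≃⇒≈ᴸ ((x ⊕ y) ⋆̄ z) (x ⋆̄ z ⊕ y ⋆̄ z) (⋆̄-distribʳ x y z)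
    ; scalarˡ     = λ k x y _ _ → ≃⇒≈ᴸ ((k · x) ⋆̄ y) (k · (x ⋆̄ y)) (⋆̄-scalarˡ k x y)
    ; scalarʳ     = λ k x y _ _ → ≃⇒≈ᴸ (x ⋆̄ (k · y)) (k · (x ⋆̄ y)) (⋆̄-scalarʳ k x y)
    ; ⋆̄-assoc     = λ x y z x∈ y∈ z∈ → ≃⇒≈ᴸ ((x ⋆̄ y) ⋆̄ z) (x ⋆̄ (y ⋆̄ z)) (⋆̄-assoc x y z x∈ y∈ z∈)
    ; ⋆̄-identityˡ = λ x x∈ → ≃⇒≈ᴸ (unit ⋆̄ x) x (⋆̄-identityˡ x x∈)
    ; ⋆̄-identityʳ = λ x x∈ → ≃⇒≈ᴸ (x ⋆̄ unit) x (⋆̄-identityʳ x x∈)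
    }

proposition2p4 : ∀ {c ℓ : Level} (K : CommutativeRing c ℓ) → IsField K → CharZero K →
                   (lam : CommutativeRing.Carrier K) → HSymDefs.IsUnitalAssocAlgebra K lam
proposition2p4 K _ _ lam = hsym-isUnitalAssocAlgebra K lam
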